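{- Let $n\ge 5$ be an integer. If $n$ is even, then $f_d(CF_n,v)=2\lfloor n/2\rfloor$ for every vertex $v\in V(CF_n)$. If $n$ is odd, then $f_d(CF_n,v)=2\lfloor n/2\rfloor$ for every $v\in V(CF_n)\setminus\{u_{(n+3)/2}\}$, and $f_d(CF_n,u_{(n+3)/2})=2\lfloor n/2\rfloor+1$.
   Context: The cuttlefish graph $CF_n$ ($n\ge 3$): start with a cycle on vertices $u_1,\dots,u_n$ with edges $u_iu_{i+1}$ (indices mod $n$). Add new vertices $v_1,\dots,v_{\lfloor n/2\rfloor-1}$ and $w_1,\dots,w_{\lfloor n/2\rfloor-1}$ with edges $u_1v_1$, $v_iv_{i+1}$ and $u_2w_1$, $w_iw_{i+1}$ for $1\le i\le\lfloor n/2\rfloor-2$ (two pendant paths of length $\lfloor n/2\rfloor-1$ attached at $u_1$ and $u_2$). The \emph{Explorer–Director game} on a finite connected graph $G$ with starting vertex $v$: a token starts on $v$; in each round, with the token on $u$, the Explorer names a distance $d$ such that some vertex is at distance $d$ from $u$, and the Director moves the token to any vertex at (shortest-path) distance exactly $d$ from $u$. Visited vertices are those the token has ever occupied (including $v$). The Explorer maximizes and the Director minimizes the number of visited vertices; the game ends when the Director can keep the token on visited vertices indefinitely; $f_d(G,v)$ is the final number of visited vertices under optimal play. -}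

module Defs where

open import Data.Nat using (ℕ; zero; suc; _+_; _*_; _∸_; _≤_; _<_; _/_)
open import Data.Fin using (Fin; toℕ)
open import Data.Fin.Subset using (Subset; _∪_; ⁅_⁆; ∣_∣)
open import Data.Product using (_×_; ∃)
open import Data.Sum using (_⊎_)
open import Relation.Nullary using (¬_)

record Graph : Set₁ where
  field
    N   : ℕ
    Adj : Fin N → Fin N → Set

module _ (G : Graph) where
  open Graph G

  data Walk : Fin N → Fin N → ℕ → Set where
    here : ∀ {x} → Walk x x 0
    step : ∀ {x y z k} → Adj x y → Walk y z k → Walk x z (suc k)

  Dist : Fin N → Fin N → ℕ → Set
  Dist x y d = Walk x y d × (∀ k → Walk x y k → d ≤ k)

  -- ExplorerForces k S u : in the Explorer–Director game, with visited set S
  -- and token on u, the Explorer can force the visited set to reach size ≥ k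
  -- (in finitely many rounds), whatever the Director does.
  data ExplorerForces (k : ℕ) : Subset N → Fin N → Set where
    done : ∀ {S u} → k ≤ ∣ S ∣ → ExplorerForces k S u
    move : ∀ {S u} (d : ℕ) →
           ∃ (λ w → Dist u w d) →
           (∀ w → Dist u w d → ExplorerForces k (S ∪ ⁅ w ⁆) w) →
           ExplorerForces k S u

  -- f_d(G, v) = k : under optimal play exactly k vertices are visited, i.e.
  -- the Explorer can force k visited vertices but not k + 1.
  FdValue : Fin N → ℕ → Set
  FdValue v k = ExplorerForces k ⁅ v ⁆ v × ¬ ExplorerForces (suc k) ⁅ v ⁆ v

-- Cuttlefish graph CF_n.  Let m = ⌊n/2⌋ - 1.  Vertex numbering (0-based):
--   i       (0 ≤ i < n)  is u_{i+1}
--   n + i   (0 ≤ i < m)  is v_{i+1}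
--   n+m+i   (0 ≤ i < m)  is w_{i+1}
cfm : ℕ → ℕ
cfm n = n / 2 ∸ 1

data CFEdge (n : ℕ) : ℕ → ℕ → Set where
  cyc  : ∀ {i} → suc i < n → CFEdge n i (suc i)
  wrap : CFEdge n (n ∸ 1) 0
  uv   : 0 < cfm n → CFEdge n 0 n
  vv   : ∀ {i} → suc i < cfm n → CFEdge n (n + i) (n + suc i)
  uw   : 0 < cfm n → CFEdge n 1 (n + cfm n)
  ww   : ∀ {i} → suc i < cfm n →
         CFEdge n (n + cfm n + i) (n + cfm n + suc i)

CF : ℕ → Graph
CF n = record
  { N   = n + cfm n + cfm n
  ; Adj = λ x y → CFEdge n (toℕ x) (toℕ y) ⊎ CFEdge n (toℕ y) (toℕ x)
  }

-- Write n = 2k + p with k = ⌊n/2⌋ and p ∈ {0, 1}. The diameter of CF_n is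
-- D = 2k − 1, realised between the tips v_{k−1} and w_{k−1} of the pendant paths.
--
-- Explorer: from any vertex, a move of its eccentricity, possibly followed by a
-- move of length D, lands on a tip or on an unvisited vertex. From a tip every
-- distance 0, …, D occurs, so while fewer than 2k vertices are visited one of
-- these distances is realised by no visited vertex, and naming it visits a new one.
--
-- Director: the geodesic v_{k−1}, …, v_1, u_1, …, u_{k+1} has 2k vertices, and every
-- distance from one of its vertices is realised inside it; the same holds for its
-- image under the reflection exchanging the pendant paths. Every vertex lies on one
-- of the two, except u_{k+2} when n is odd.
--
-- From u_{k+2} (n odd) the Director keeps to the geodesic and u_{k+2}. The Explorer
-- gets the extra vertex because at a tip u_{k+2} is at distance D, like two other
-- vertices: if one of them is visited, the pigeonhole argument above ignores
-- u_{k+2}; otherwise a short chase from the tip reaches a new vertex.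

module Submission where

open import Defs
open import Data.Nat using (ℕ; zero; suc; _+_; _*_; _∸_; _≤_; _≰_; _<_; _/_; _%_; _⊓_; ∣_-_∣; pred; z≤n; s≤s; s≤s⁻¹; _≤?_; _<?_; _≟_)
open import Data.Nat.Properties
open import Data.Nat.DivMod using (m≡m%n+[m/n]*n; m%n<n; /-monoˡ-≤)
open import Data.Fin using (Fin; toℕ; fromℕ<)
open import Data.Fin.Properties using (any?; toℕ-fromℕ<; toℕ<n; toℕ-injective) renaming (_≟_ to _≟ᶠ_)
open import Data.Fin.Subset using (Subset; _∪_; ⁅_⁆; ∣_∣; _∈_; _∉_; _⊆_; inside; outside) renaming (⊥ to ∅; _-_ to _∖_)
open import Data.Fin.Subset.Properties
  using (_∈?_; ∉⊥; ∣⊥∣≡0; x∈⁅x⁆; x∈⁅y⁆⇒x≡y; ∣⁅x⁆∣≡1; ⊆-antisym; p⊆q⇒∣p∣≤∣q∣; p⊂q⇒∣p∣<∣q∣;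
         p⊆p∪q; x∈p∪q⁺; x∈p∪q⁻; x∈p⇒∣p-x∣<∣p∣; x∈p∧x≢y⇒x∈p-y)
open import Data.Vec using ([]; _∷_)
open import Data.Product using (_×_; ∃; _,_; proj₁; proj₂; swap)
open import Data.Sum using (_⊎_; inj₁; inj₂; [_,_]′)
import Data.Sum
open import Data.Empty using (⊥; ⊥-elim)
open import Data.Unit using (⊤; tt)
open import Function using (id; _∘_)
open import Relation.Nullary using (¬_; Dec; yes; no)
open import Relation.Nullary.Decidable using (_×-dec_; ¬?; decidable-stable)
open import Relation.Binary using (tri<; tri≈; tri>)
open import Relation.Binary.PropositionalEquality


-- Counting in finite subsets

module _ {N : ℕ} where

  x∈p∪⁅x⁆ : ∀ {p : Subset N} x → x ∈ p ∪ ⁅ x ⁆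
  x∈p∪⁅x⁆ x = x∈p∪q⁺ (inj₂ (x∈⁅x⁆ x))

  x∈p⇒p∪⁅x⁆≡p : ∀ {p : Subset N} {x} → x ∈ p → p ∪ ⁅ x ⁆ ≡ p
  x∈p⇒p∪⁅x⁆≡p {p} {x} x∈p = ⊆-antisym (λ {y} y∈ → [ id , x∈p-if-y≡x y ]′ (x∈p∪q⁻ p ⁅ x ⁆ y∈)) (p⊆p∪q ⁅ x ⁆)
    where
    x∈p-if-y≡x : ∀ y → y ∈ ⁅ x ⁆ → y ∈ p
    x∈p-if-y≡x y y∈⁅x⁆ rewrite x∈⁅y⁆⇒x≡y x y∈⁅x⁆ = x∈p

  x∉p⇒∣p∣<∣p∪⁅x⁆∣ : ∀ {p : Subset N} {x} → x ∉ p → ∣ p ∣ < ∣ p ∪ ⁅ x ⁆ ∣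
  x∉p⇒∣p∣<∣p∪⁅x⁆∣ {x = x} x∉p = p⊂q⇒∣p∣<∣q∣ (p⊆p∪q ⁅ x ⁆ , x , x∈p∪⁅x⁆ x , x∉p)

∣p∪q∣≤∣p∣+∣q∣ : ∀ {N} (p q : Subset N) → ∣ p ∪ q ∣ ≤ ∣ p ∣ + ∣ q ∣
∣p∪q∣≤∣p∣+∣q∣ [] [] = z≤n
∣p∪q∣≤∣p∣+∣q∣ (outside ∷ p) (outside ∷ q) = ∣p∪q∣≤∣p∣+∣q∣ p q
∣p∪q∣≤∣p∣+∣q∣ (outside ∷ p) (inside ∷ q) = ≤-trans (s≤s (∣p∪q∣≤∣p∣+∣q∣ p q)) (≤-reflexive (sym (+-suc _ _)))
∣p∪q∣≤∣p∣+∣q∣ (inside ∷ p) (outside ∷ q) = s≤s (∣p∪q∣≤∣p∣+∣q∣ p q)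
∣p∪q∣≤∣p∣+∣q∣ (inside ∷ p) (inside ∷ q) = s≤s (≤-trans (∣p∪q∣≤∣p∣+∣q∣ p q) (+-monoʳ-≤ ∣ p ∣ (n≤1+n _)))

module _ {N : ℕ} (g : ℕ → Fin N) where

  image : ℕ → Subset N
  image zero = ∅
  image (suc B) = image B ∪ ⁅ g B ⁆

  ∣image∣≤ : ∀ B → ∣ image B ∣ ≤ B
  ∣image∣≤ zero = ≤-reflexive (∣⊥∣≡0 N)
  ∣image∣≤ (suc B) = begin
    ∣ image B ∪ ⁅ g B ⁆ ∣      ≤⟨ ∣p∪q∣≤∣p∣+∣q∣ (image B) ⁅ g B ⁆ ⟩
    ∣ image B ∣ + ∣ ⁅ g B ⁆ ∣  ≤⟨ +-mono-≤ (∣image∣≤ B) (≤-reflexive (∣⁅x⁆∣≡1 (g B))) ⟩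
    B + 1                      ≡⟨ +-comm B 1 ⟩
    suc B                      ∎
    where open ≤-Reasoning

  ∈image⁺ : ∀ {B i} → i < B → g i ∈ image B
  ∈image⁺ {suc B} {i} i<1+B with m≤n⇒m<n∨m≡n (s≤s⁻¹ i<1+B)
  ... | inj₁ i<B = x∈p∪q⁺ (inj₁ (∈image⁺ i<B))
  ... | inj₂ refl = x∈p∪⁅x⁆ (g i)

  ∈image⁻ : ∀ {B x} → x ∈ image B → ∃ λ i → i < B × x ≡ g i
  ∈image⁻ {zero} x∈∅ = ⊥-elim (∉⊥ x∈∅)
  ∈image⁻ {suc B} {x} x∈ with x∈p∪q⁻ (image B) ⁅ g B ⁆ x∈
  ... | inj₁ x∈image with ∈image⁻ x∈image
  ...   | i , i<B , x≡gi = i , m≤n⇒m≤1+n i<B , x≡gi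
  ∈image⁻ {suc B} {x} x∈ | inj₂ x∈⁅gB⁆ = B , ≤-refl , x∈⁅y⁆⇒x≡y (g B) x∈⁅gB⁆

module _ {N : ℕ} (f : Fin N → ℕ) where

  Attains : Subset N → ℕ → Set
  Attains p i = ∃ λ z → z ∈ p × f z ≡ i

  attains-below⇒≤∣p∣ : ∀ K (p : Subset N) → (∀ {i} → i < K → Attains p i) → K ≤ ∣ p ∣
  attains-below⇒≤∣p∣ zero p _ = z≤n
  attains-below⇒≤∣p∣ (suc K) p attains with attains ≤-refl
  ... | z , z∈p , fz≡K = begin
    suc K            ≤⟨ s≤s (attains-below⇒≤∣p∣ K (p ∖ z) attains-in-p-z) ⟩
    suc ∣ p ∖ z ∣    ≤⟨ x∈p⇒∣p-x∣<∣p∣ z∈p ⟩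
    ∣ p ∣            ∎
    where
    open ≤-Reasoning
    attains-in-p-z : ∀ {i} → i < K → Attains (p ∖ z) i
    attains-in-p-z {i} i<K with attains (m≤n⇒m≤1+n i<K)
    ... | y , y∈p , fy≡i = y , x∈p∧x≢y⇒x∈p-y y∈p y≢z , fy≡i
      where
      y≢z : y ≢ z
      y≢z y≡z = <⇒≢ i<K (trans (sym fy≡i) (trans (cong f y≡z) fz≡K))

  attains? : ∀ p i → Dec (Attains p i)
  attains? p i = any? (λ z → (z ∈? p) ×-dec (f z ≟ i))

  missed-level : ∀ K (p : Subset N) → ∣ p ∣ < K → ∃ λ i → i < K × ¬ Attains p i
  missed-level K p ∣p∣<K with anyUpTo? (λ i → ¬? (attains? p i)) K
  ... | yes missed = missed
  ... | no none = ⊥-elim (<⇒≱ ∣p∣<K (attains-below⇒≤∣p∣ K p λ {i} i<K →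
          decidable-stable (attains? p i) λ ¬attains → none (i , i<K , ¬attains)))

-- The game on an arbitrary graph

module GraphGame (G : Graph) where
  open Graph G

  walk-snoc : ∀ {x y z ℓ} → Walk G x y ℓ → Adj y z → Walk G x z (suc ℓ)
  walk-snoc here y~z = step y~z here
  walk-snoc (step x~x' w) y~z = step x~x' (walk-snoc w y~z)

  Lipschitz : (Fin N → ℕ) → Set
  Lipschitz f = ∀ {x y} → Adj x y → f y ≤ suc (f x)

  lipschitz-walk : ∀ {f} → Lipschitz f → ∀ {x y ℓ} → Walk G x y ℓ → f y ≤ f x + ℓ
  lipschitz-walk {f} lip {x} here = ≤-reflexive (sym (+-identityʳ (f x)))
  lipschitz-walk {f} lip {x} {y} {suc ℓ} (step {y = x'} x~x' w) = begin
    f y              ≤⟨ lipschitz-walk lip w ⟩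
    f x' + ℓ         ≤⟨ +-monoˡ-≤ ℓ (lip x~x') ⟩
    suc (f x) + ℓ    ≡⟨ sym (+-suc (f x) ℓ) ⟩
    f x + suc ℓ      ∎
    where open ≤-Reasoning

  FreshForces : ℕ → Subset N → Set
  FreshForces K S = ∀ w → w ∉ S → ExplorerForces G K (S ∪ ⁅ w ⁆) w

  landing : ∀ {K S w} → FreshForces K S → (w ∈ S → ExplorerForces G K S w) →
    ExplorerForces G K (S ∪ ⁅ w ⁆) w
  landing {K} {S} {w} fresh visited with w ∈? S
  ... | yes w∈S = subst (λ T → ExplorerForces G K T w) (sym (x∈p⇒p∪⁅x⁆≡p w∈S)) (visited w∈S)
  ... | no w∉S = fresh w w∉S

  forces-by-progress : ∀ K (Inv : Subset N → Set) →
    (∀ {S w} → Inv S → Inv (S ∪ ⁅ w ⁆)) →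
    (∀ {S u} → Inv S → ∣ S ∣ < K → FreshForces K S → ExplorerForces G K S u) →
    ∀ {S u} → Inv S → ExplorerForces G K S u
  forces-by-progress K Inv Inv-∪ progress {S} inv = go K (m≤n+m K ∣ S ∣) inv
    where
    go : ∀ t {S u} → K ≤ ∣ S ∣ + t → Inv S → ExplorerForces G K S u
    go zero {S} K≤ _ = done (subst (K ≤_) (+-identityʳ ∣ S ∣) K≤)
    go (suc t) {S} K≤ inv with K ≤? ∣ S ∣
    ... | yes K≤∣S∣ = done K≤∣S∣
    ... | no K≰∣S∣ = progress inv (≰⇒> K≰∣S∣) λ w w∉S → go t (K≤′ w∉S) (Inv-∪ inv)
      where
      K≤′ : ∀ {w} → w ∉ S → K ≤ ∣ S ∪ ⁅ w ⁆ ∣ + t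
      K≤′ w∉S = ≤-trans K≤ (≤-trans (≤-reflexive (+-suc ∣ S ∣ t)) (+-monoˡ-≤ t (x∉p⇒∣p∣<∣p∪⁅x⁆∣ w∉S)))

  -- A function δ with these properties is the graph distance.
  module Metric (δ : Fin N → Fin N → ℕ)
    (δ-refl : ∀ x → δ x x ≡ 0)
    (δ≡0⇒≡ : ∀ {x y} → δ x y ≡ 0 → y ≡ x)
    (δ-lipschitz : ∀ x → Lipschitz (δ x))
    (δ-parent : ∀ {x y t} → δ x y ≡ suc t → ∃ λ y' → Adj y' y × δ x y' ≡ t) where

    δ-walk : ∀ {x y t} → δ x y ≡ t → Walk G x y t
    δ-walk {t = zero} δ≡0 rewrite δ≡0⇒≡ δ≡0 = here
    δ-walk {t = suc t} δ≡1+t with δ-parent δ≡1+t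
    ... | y' , y'~y , δ≡t = walk-snoc (δ-walk δ≡t) y'~y

    walk⇒δ≤ : ∀ {x y ℓ} → Walk G x y ℓ → δ x y ≤ ℓ
    walk⇒δ≤ {x} {y} {ℓ} w = subst (λ d → δ x y ≤ d + ℓ) (δ-refl x) (lipschitz-walk (δ-lipschitz x) w)

    ≡δ⇒Dist : ∀ {x y d} → δ x y ≡ d → Dist G x y d
    ≡δ⇒Dist δ≡d = δ-walk δ≡d , λ _ w → subst (_≤ _) δ≡d (walk⇒δ≤ w)

    Dist⇒≡δ : ∀ {x y d} → Dist G x y d → δ x y ≡ d
    Dist⇒≡δ (w , shortest) = ≤-antisym (walk⇒δ≤ w) (shortest _ (δ-walk refl))

    explore : ∀ {K S u} d → (∃ λ w → δ u w ≡ d) →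
      (∀ w → δ u w ≡ d → ExplorerForces G K (S ∪ ⁅ w ⁆) w) → ExplorerForces G K S u
    explore d (w , δ≡d) next = move d (w , ≡δ⇒Dist δ≡d) λ w dist → next w (Dist⇒≡δ dist)

    -- The Director can answer every move from within T.
    Closed : Subset N → Set
    Closed T = ∀ {u} → u ∈ T → ∀ y → ∃ λ z → z ∈ T × δ u z ≡ δ u y

    director-bound : ∀ {T} → Closed T → ∀ {K S u} → u ∈ T → S ⊆ T →
      ExplorerForces G K S u → K ≤ ∣ T ∣
    director-bound {T} closed u∈T S⊆T (done K≤∣S∣) = ≤-trans K≤∣S∣ (p⊆q⇒∣p∣≤∣q∣ S⊆T)
    director-bound {T} closed {S = S} {u} u∈T S⊆T (move d (y , dist) next) with closed u∈T y
    ... | z , z∈T , δ≡ = director-bound closed z∈T S∪z⊆T (next z (≡δ⇒Dist (trans δ≡ (Dist⇒≡δ dist))))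
      where
      S∪z⊆T : S ∪ ⁅ z ⁆ ⊆ T
      S∪z⊆T x∈ with x∈p∪q⁻ S ⁅ z ⁆ x∈
      ... | inj₁ x∈S = S⊆T x∈S
      ... | inj₂ x∈⁅z⁆ rewrite x∈⁅y⁆⇒x≡y z x∈⁅z⁆ = z∈T

    geodesic-closed : ∀ (g : ℕ → Fin N) B →
      (∀ {q q'} → q < B → q' < B → δ (g q) (g q') ≡ ∣ q - q' ∣) →
      (∀ {q} → q < B → ∀ y → δ (g q) y ≤ q ⊎ q + δ (g q) y < B) →
      Closed (image g B)
    geodesic-closed g B isometric short {u} u∈ y with ∈image⁻ g u∈
    ... | q , q<B , refl with short q<B y
    ...   | inj₁ d≤q = g (q ∸ d) , ∈image⁺ g q∸d<B , (begin
      δ (g q) (g (q ∸ d))    ≡⟨ isometric q<B q∸d<B ⟩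
      ∣ q - q ∸ d ∣          ≡⟨ m≤n⇒∣n-m∣≡n∸m (m∸n≤m q d) ⟩
      q ∸ (q ∸ d)            ≡⟨ m∸[m∸n]≡n d≤q ⟩
      d                      ∎)
      where
      open ≡-Reasoning
      d : ℕ
      d = δ (g q) y
      q∸d<B : q ∸ d < B
      q∸d<B = ≤-<-trans (m∸n≤m q d) q<B
    ...   | inj₂ q+d<B = g (q + δ (g q) y) , ∈image⁺ g q+d<B ,
      trans (isometric q<B q+d<B) (∣m-m+n∣≡n q _)

    closed-∪-⁅⁆ : ∀ {T s} → Closed T → (∀ y → ∃ λ z → z ∈ T ∪ ⁅ s ⁆ × δ s z ≡ δ s y) →
      Closed (T ∪ ⁅ s ⁆)
    closed-∪-⁅⁆ {T} {s} closed from-s {u} u∈ y with x∈p∪q⁻ T ⁅ s ⁆ u∈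
    ... | inj₁ u∈T with closed u∈T y
    ...   | z , z∈T , δ≡ = z , p⊆p∪q ⁅ s ⁆ z∈T , δ≡
    closed-∪-⁅⁆ {T} {s} closed from-s {u} u∈ y | inj₂ u∈⁅s⁆ rewrite x∈⁅y⁆⇒x≡y s u∈⁅s⁆ = from-s y

    -- From b every distance below R is available; if S shows fewer than R
    -- distinct distances from b, one of the others leads to a new vertex.
    rich-progress : ∀ {K R S S' b} → (∀ {d} → d < R → ∃ λ w → δ b w ≡ d) → ∣ S' ∣ < R →
      (∀ {z} → z ∈ S → ∃ λ z' → z' ∈ S' × δ b z' ≡ δ b z) → FreshForces K S →
      ExplorerForces G K S b
    rich-progress {R = R} {S' = S'} {b} rich ∣S'∣<R represented fresh with missed-level (δ b) R S' ∣S'∣<R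
    ... | d , d<R , missed = explore d (rich d<R) λ w δ≡d → fresh w λ w∈S →
      let z' , z'∈S' , δ≡ = represented w∈S in missed (z' , z'∈S' , trans δ≡ δ≡d)

    director-caps : ∀ {T v B} → Closed T → ∣ T ∣ ≤ B → v ∈ T →
      ¬ ExplorerForces G (suc B) ⁅ v ⁆ v
    director-caps {T} {v} closed ∣T∣≤B v∈T forces =
      1+n≰n (≤-trans (director-bound closed v∈T ⁅v⁆⊆T forces) ∣T∣≤B)
      where
      ⁅v⁆⊆T : ⁅ v ⁆ ⊆ T
      ⁅v⁆⊆T x∈ rewrite x∈⁅y⁆⇒x≡y v x∈ = v∈T

∸-lipschitz : ∀ m a b → b ≤ suc a → m ∸ a ≤ suc (m ∸ b)
∸-lipschitz zero a b _ = ≤-trans (≤-reflexive (0∸n≡0 a)) z≤n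
∸-lipschitz (suc m) zero zero _ = n≤1+n _
∸-lipschitz (suc m) zero (suc zero) _ = ≤-refl
∸-lipschitz (suc m) zero (suc (suc b)) (s≤s ())
∸-lipschitz (suc m) (suc a) zero _ = ≤-trans (m∸n≤m m a) (m≤n⇒m≤1+n (n≤1+n m))
∸-lipschitz (suc m) (suc a) (suc b) b≤1+a = ∸-lipschitz m a b (s≤s⁻¹ b≤1+a)

∣m-1+n∣≤1+∣m-n∣ : ∀ m n → ∣ m - suc n ∣ ≤ suc ∣ m - n ∣
∣m-1+n∣≤1+∣m-n∣ zero n = ≤-refl
∣m-1+n∣≤1+∣m-n∣ (suc m) zero = ≤-trans (≤-reflexive (∣-∣-identityʳ m)) (m≤n⇒m≤1+n (n≤1+n m))
∣m-1+n∣≤1+∣m-n∣ (suc m) (suc n) = ∣m-1+n∣≤1+∣m-n∣ m n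

∣m-n∣≤1+∣m-1+n∣ : ∀ m n → ∣ m - n ∣ ≤ suc ∣ m - suc n ∣
∣m-n∣≤1+∣m-1+n∣ zero n = m≤n⇒m≤1+n (n≤1+n n)
∣m-n∣≤1+∣m-1+n∣ (suc m) zero = s≤s (≤-reflexive (sym (∣-∣-identityʳ m)))
∣m-n∣≤1+∣m-1+n∣ (suc m) (suc n) = ∣m-n∣≤1+∣m-1+n∣ m n

∣m∸n-m∸o∣≡∣n-o∣ : ∀ m {n o} → n ≤ m → o ≤ m → ∣ m ∸ n - m ∸ o ∣ ≡ ∣ n - o ∣
∣m∸n-m∸o∣≡∣n-o∣ zero {zero} {zero} _ _ = refl
∣m∸n-m∸o∣≡∣n-o∣ (suc m) {zero} {zero} _ _ = ∣n-n∣≡0 (suc m)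
∣m∸n-m∸o∣≡∣n-o∣ (suc m) {suc n} {suc o} n≤ o≤ = ∣m∸n-m∸o∣≡∣n-o∣ m (s≤s⁻¹ n≤) (s≤s⁻¹ o≤)
∣m∸n-m∸o∣≡∣n-o∣ (suc m) {zero} {suc o} _ o≤ = trans (m≤n⇒∣n-m∣≡n∸m (≤-trans (m∸n≤m m o) (n≤1+n m)))
  (trans (+-∸-assoc 1 (m∸n≤m m o)) (cong suc (m∸[m∸n]≡n (s≤s⁻¹ o≤))))
∣m∸n-m∸o∣≡∣n-o∣ (suc m) {suc n} {zero} n≤ _ = trans (m≤n⇒∣m-n∣≡n∸m (≤-trans (m∸n≤m m n) (n≤1+n m)))
  (trans (+-∸-assoc 1 (m∸n≤m m n)) (cong suc (m∸[m∸n]≡n (s≤s⁻¹ n≤))))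

m⊓1+n≤1+[n⊓1+m] : ∀ m n → m ⊓ suc n ≤ suc (n ⊓ suc m)
m⊓1+n≤1+[n⊓1+m] m n = begin
  m ⊓ suc n                ≡⟨ ⊓-comm m (suc n) ⟩
  suc n ⊓ m                ≤⟨ ⊓-monoʳ-≤ (suc n) (m≤n⇒m≤1+n (n≤1+n m)) ⟩
  suc n ⊓ suc (suc m)      ≡⟨ sym (+-distribˡ-⊓ 1 n (suc m)) ⟩
  suc (n ⊓ suc m)          ∎
  where open ≤-Reasoning

∣m-1+m+n∣≡1+n : ∀ m n → ∣ m - suc (m + n) ∣ ≡ suc n
∣m-1+m+n∣≡1+n m n = trans (cong (∣ m -_∣) (sym (+-suc m n))) (∣m-m+n∣≡n m (suc n))

∣1+m+n-m∣≡1+n : ∀ m n → ∣ suc (m + n) - m ∣ ≡ suc n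
∣1+m+n-m∣≡1+n m n = trans (∣-∣-comm (suc (m + n)) m) (∣m-1+m+n∣≡1+n m n)

∣m-n∣-step : ∀ i j {t} → ∣ i - j ∣ ≡ suc t →
  (∃ λ j' → suc j' ≡ j × ∣ i - j' ∣ ≡ t) ⊎ (suc j ≤ i × ∣ i - suc j ∣ ≡ t)
∣m-n∣-step zero (suc j) e = inj₁ (j , refl , suc-injective e)
∣m-n∣-step (suc i) zero e = inj₂ (s≤s z≤n , trans (∣-∣-identityʳ i) (suc-injective e))
∣m-n∣-step (suc i) (suc j) e with ∣m-n∣-step i j e
... | inj₁ (j' , refl , e') = inj₁ (suc j' , refl , e')
... | inj₂ (1+j≤i , e') = inj₂ (s≤s 1+j≤i , e')

+-tight : ∀ {x y X Y} → x ≤ X → y ≤ Y → x + y ≡ X + Y → x ≡ X × y ≡ Y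
+-tight {x} {y} {X} {Y} x≤X y≤Y e with m≤n⇒m<n∨m≡n x≤X | m≤n⇒m<n∨m≡n y≤Y
... | inj₂ x≡X | _ = x≡X , +-cancelˡ-≡ x y Y (trans e (cong (_+ Y) (sym x≡X)))
... | inj₁ x<X | inj₂ y≡Y = ⊥-elim (<⇒≢ (+-monoˡ-< y x<X) (trans e (cong (X +_) (sym y≡Y))))
... | inj₁ x<X | inj₁ y<Y = ⊥-elim (<⇒≢ (+-mono-< x<X y<Y) e)

m+1+n≡1⇒m≡0 : ∀ m n → m + suc n ≡ 1 → m ≡ 0
m+1+n≡1⇒m≡0 m n e = m+n≡0⇒m≡0 m (suc-injective (trans (sym (+-suc m n)) e))

≤1⇒≡0⊎≡1 : ∀ {q} → q ≤ 1 → q ≡ 0 ⊎ q ≡ 1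
≤1⇒≡0⊎≡1 {zero} _ = inj₁ refl
≤1⇒≡0⊎≡1 {suc zero} _ = inj₂ refl
≤1⇒≡0⊎≡1 {suc (suc q)} (s≤s ())

∣q-1+a+i∣≡1+[a∸q]+i : ∀ {q a} i → q ≤ a → ∣ q - suc a + i ∣ ≡ suc (a ∸ q) + i
∣q-1+a+i∣≡1+[a∸q]+i {q} {a} i q≤a = begin
  ∣ q - suc a + i ∣    ≡⟨ m≤n⇒∣m-n∣≡n∸m (≤-trans q≤a (≤-trans (n≤1+n a) (m≤m+n (suc a) i))) ⟩
  suc a + i ∸ q        ≡⟨ +-∸-comm i (≤-trans q≤a (n≤1+n a)) ⟩
  suc a ∸ q + i        ≡⟨ cong (_+ i) (+-∸-assoc 1 q≤a) ⟩
  suc (a ∸ q) + i      ∎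
  where open ≡-Reasoning

∣1+m-m∣≡1 : ∀ m → ∣ suc m - m ∣ ≡ 1
∣1+m-m∣≡1 zero = refl
∣1+m-m∣≡1 (suc m) = ∣1+m-m∣≡1 m

∣1+m-n∣≡1⇒ : ∀ m n → ∣ suc m - n ∣ ≡ 1 → n ≡ m ⊎ n ≡ suc (suc m)
∣1+m-n∣≡1⇒ m zero e = inj₁ (sym (suc-injective e))
∣1+m-n∣≡1⇒ zero (suc n) e = inj₂ (cong suc e)
∣1+m-n∣≡1⇒ (suc m) (suc n) e with ∣1+m-n∣≡1⇒ m n e
... | inj₁ n≡m = inj₁ (cong suc n≡m)
... | inj₂ n≡2+m = inj₂ (cong suc n≡2+m)

Near : ℕ → ℕ → Set
Near x y = x ≤ suc y × y ≤ suc x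

Near-suc : ∀ x → Near (suc x) x
Near-suc x = ≤-refl , m≤n⇒m≤1+n (n≤1+n x)

Near-+ˡ : ∀ c {x y} → Near x y → Near (c + x) (c + y)
Near-+ˡ c {x} {y} (x≤ , y≤) = ≤-trans (+-monoʳ-≤ c x≤) (≤-reflexive (+-suc c y)) , ≤-trans (+-monoʳ-≤ c y≤) (≤-reflexive (+-suc c x))

∣m-n∣-Near : ∀ m n → Near ∣ m - suc n ∣ ∣ m - n ∣
∣m-n∣-Near m n = ∣m-1+n∣≤1+∣m-n∣ m n , ∣m-n∣≤1+∣m-1+n∣ m n

-- Distance on the cycle C_n

module CycleDistance (n : ℕ) where

  arc : ℕ → ℕ
  arc t = t ⊓ (n ∸ t)

  cycDist : ℕ → ℕ → ℕ
  cycDist i j = arc ∣ i - j ∣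

  data CycleAdj : ℕ → ℕ → Set where
    next : ∀ {i} → suc i < n → CycleAdj i (suc i)
    wrap : CycleAdj (n ∸ 1) 0

  arc≤ : ∀ t → arc t ≤ t
  arc≤ t = m⊓n≤m t _

  arc≤n∸ : ∀ t → arc t ≤ n ∸ t
  arc≤n∸ t = m⊓n≤n t _

  arc≡ : ∀ {t} → t ≤ n ∸ t → arc t ≡ t
  arc≡ = m≤n⇒m⊓n≡m

  arc≡n∸ : ∀ {t} → n ∸ t ≤ t → arc t ≡ n ∸ t
  arc≡n∸ = m≥n⇒m⊓n≡n

  arc≡0⇒≡0 : ∀ {t} → t < n → arc t ≡ 0 → t ≡ 0
  arc≡0⇒≡0 {t} t<n e with ⊓-sel t (n ∸ t)
  ... | inj₁ arc≡t = trans (sym arc≡t) e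
  ... | inj₂ arc≡n∸t = ⊥-elim (<⇒≢ (m<n⇒0<n∸m t<n) (sym (trans (sym arc≡n∸t) e)))

  arc-lipschitz : ∀ {t t'} → Near t' t → arc t' ≤ suc (arc t)
  arc-lipschitz {t} {t'} (t'≤ , t≤) = begin
    t' ⊓ (n ∸ t')             ≤⟨ ⊓-mono-≤ t'≤ (∸-lipschitz n t' t t≤) ⟩
    suc t ⊓ suc (n ∸ t)       ≡⟨ sym (+-distribˡ-⊓ 1 t (n ∸ t)) ⟩
    suc (arc t)               ∎
    where open ≤-Reasoning

  arc-Near : ∀ {t t'} → Near t' t → Near (arc t') (arc t)
  arc-Near near = arc-lipschitz near , arc-lipschitz (swap near)

  cycDist-comm : ∀ i j → cycDist i j ≡ cycDist j i
  cycDist-comm i j = cong arc (∣-∣-comm i j)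

  module _ {i r} (n≡ : n ≡ suc (i + r)) where

    cycDist-to-0 : cycDist i 0 ≡ i ⊓ suc r
    cycDist-to-0 rewrite n≡ | ∣-∣-identityʳ i =
      cong (i ⊓_) (trans (+-∸-assoc 1 (m≤m+n i r)) (cong suc (m+n∸m≡n i r)))

    cycDist-to-last : cycDist i (n ∸ 1) ≡ r ⊓ suc i
    cycDist-to-last rewrite n≡ | ∣m-m+n∣≡n i r =
      cong (r ⊓_) (trans (cong (_∸ r) (cong suc (+-comm i r)))
                         (trans (+-∸-assoc 1 (m≤m+n r i)) (cong suc (m+n∸m≡n r i))))

  cycDist-wrap : ∀ {i} → i < n → Near (cycDist i 0) (cycDist i (n ∸ 1))
  cycDist-wrap {i} i<n = bounds (sym (m+[n∸m]≡n i<n))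
    where
    bounds : ∀ {r} → n ≡ suc (i + r) → Near (cycDist i 0) (cycDist i (n ∸ 1))
    bounds {r} n≡ rewrite cycDist-to-0 {i} {r} n≡ | cycDist-to-last {i} {r} n≡ =
      m⊓1+n≤1+[n⊓1+m] i r , m⊓1+n≤1+[n⊓1+m] r i

  cycDist-adj : ∀ {i j j'} → i < n → CycleAdj j j' → Near (cycDist i j') (cycDist i j)
  cycDist-adj {i} {j} _ (next _) = arc-Near (∣m-n∣-Near i j)
  cycDist-adj i<n wrap = cycDist-wrap i<n

  arc-rising : ∀ {s} → suc s ≤ n ∸ suc s → suc (arc s) ≡ arc (suc s)
  arc-rising {s} 1+s≤ = trans (cong suc (arc≡ s≤n∸s)) (sym (arc≡ 1+s≤))
    where
    s≤n∸s : s ≤ n ∸ s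
    s≤n∸s = ≤-trans (n≤1+n s) (≤-trans 1+s≤ (∸-monoʳ-≤ n (n≤1+n s)))

  arc-falling : ∀ {s} → n ∸ suc s < suc s → suc (suc s) ≤ n → suc (arc (suc (suc s))) ≡ arc (suc s)
  arc-falling {s} n∸1+s<1+s 2+s≤n = begin
    suc (arc (suc (suc s)))    ≡⟨ cong suc (arc≡n∸ (≤-trans (∸-monoʳ-≤ n (n≤1+n (suc s))) (≤-trans (<⇒≤ n∸1+s<1+s) (n≤1+n (suc s))))) ⟩
    suc (n ∸ suc (suc s))      ≡⟨ sym (+-∸-assoc 1 2+s≤n) ⟩
    n ∸ suc s                  ≡⟨ sym (arc≡n∸ (<⇒≤ n∸1+s<1+s)) ⟩
    arc (suc s)                ∎
    where open ≡-Reasoning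

  CycleParent : ℕ → ℕ → Set
  CycleParent i j = ∃ λ j' → j' < n × (CycleAdj j' j ⊎ CycleAdj j j') × suc (cycDist i j') ≡ cycDist i j

  parent-above : ∀ i s → suc (i + s) < n → CycleParent i (suc (i + s))
  parent-above i s j<n with suc s ≤? n ∸ suc s
  ... | yes rising = i + s , <-trans (n<1+n _) j<n , inj₁ (next j<n) , (begin
    suc (arc ∣ i - i + s ∣)    ≡⟨ cong (suc ∘ arc) (∣m-m+n∣≡n i s) ⟩
    suc (arc s)                ≡⟨ arc-rising rising ⟩
    arc (suc s)                ≡⟨ cong arc (sym (∣m-1+m+n∣≡1+n i s)) ⟩
    cycDist i (suc (i + s))    ∎)
    where open ≡-Reasoning
  ... | no falling with suc (suc (i + s)) <? n
  ...   | yes 1+j<n = suc (suc (i + s)) , 1+j<n , inj₂ (next 1+j<n) , (begin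
    suc (arc ∣ i - suc (suc (i + s)) ∣)  ≡⟨ cong (suc ∘ arc) (trans (cong (λ x → ∣ i - suc x ∣) (sym (+-suc i s))) (∣m-1+m+n∣≡1+n i (suc s))) ⟩
    suc (arc (suc (suc s)))              ≡⟨ arc-falling (≰⇒> falling) (≤-trans (s≤s (s≤s (m≤n+m s i))) (<⇒≤ 1+j<n)) ⟩
    arc (suc s)                          ≡⟨ cong arc (sym (∣m-1+m+n∣≡1+n i s)) ⟩
    cycDist i (suc (i + s))              ∎)
    where open ≡-Reasoning
  ...   | no 1+j≮n = 0 , ≤-trans (s≤s z≤n) j<n , inj₂ (subst (λ x → CycleAdj x 0) (sym j≡n∸1) wrap) , (begin
    suc (arc ∣ i - 0 ∣)        ≡⟨ cong (suc ∘ arc) (∣-∣-identityʳ i) ⟩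
    suc (arc i)                ≡⟨ cong suc (arc≡ i≤n∸i) ⟩
    suc i                      ≡⟨ sym n∸1+s≡1+i ⟩
    n ∸ suc s                  ≡⟨ sym (arc≡n∸ (<⇒≤ (≰⇒> falling))) ⟩
    arc (suc s)                ≡⟨ cong arc (sym (∣m-1+m+n∣≡1+n i s)) ⟩
    cycDist i (suc (i + s))    ∎)
    where
    open ≡-Reasoning
    n≡ : n ≡ suc (suc (i + s))
    n≡ = sym (≤-antisym j<n (≮⇒≥ 1+j≮n))
    j≡n∸1 : suc (i + s) ≡ n ∸ 1
    j≡n∸1 = cong (_∸ 1) (sym n≡)
    n∸1+s≡1+i : n ∸ suc s ≡ suc i
    n∸1+s≡1+i rewrite n≡ = trans (cong (λ x → suc x ∸ s) (+-comm i s)) (trans (cong (_∸ s) (sym (+-suc s i))) (m+n∸m≡n s (suc i)))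
    i≤n∸i : i ≤ n ∸ i
    i≤n∸i = ≤-trans (n≤1+n i) (≤-trans (subst (_≤ suc s) n∸1+s≡1+i (<⇒≤ (≰⇒> falling))) (≤-trans (n≤1+n _) (≤-reflexive (sym n∸i≡2+s))))
      where
      n∸i≡2+s : n ∸ i ≡ suc (suc s)
      n∸i≡2+s rewrite n≡ = trans (+-∸-assoc 2 (m≤m+n i s)) (cong (suc ∘ suc) (m+n∸m≡n i s))

  parent-below : ∀ j s → suc (j + s) < n → CycleParent (suc (j + s)) j
  parent-below j s i<n with suc s ≤? n ∸ suc s
  ... | yes rising = suc j , 1+j<n , inj₂ (next 1+j<n) , (begin
    suc (arc ∣ suc (j + s) - suc j ∣)  ≡⟨ cong (suc ∘ arc) (trans (∣-∣-comm (j + s) j) (∣m-m+n∣≡n j s)) ⟩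
    suc (arc s)                        ≡⟨ arc-rising rising ⟩
    arc (suc s)                        ≡⟨ cong arc (sym (∣1+m+n-m∣≡1+n j s)) ⟩
    cycDist (suc (j + s)) j            ∎)
    where
    open ≡-Reasoning
    1+j<n : suc j < n
    1+j<n = ≤-trans (s≤s (s≤s (m≤m+n j s))) i<n
  parent-below (suc j) s i<n | no falling = j , <-trans (n<1+n j) 1+j<n , inj₁ (next 1+j<n) , (begin
    suc (arc ∣ suc (suc j + s) - j ∣)  ≡⟨ cong (suc ∘ arc) (trans (cong (λ x → ∣ suc x - j ∣) (sym (+-suc j s))) (∣1+m+n-m∣≡1+n j (suc s))) ⟩
    suc (arc (suc (suc s)))            ≡⟨ arc-falling (≰⇒> falling) (≤-trans (s≤s (s≤s (m≤n+m s j))) (<⇒≤ i<n)) ⟩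
    arc (suc s)                        ≡⟨ cong arc (sym (∣1+m+n-m∣≡1+n (suc j) s)) ⟩
    cycDist (suc (suc j + s)) (suc j)  ∎)
    where
    open ≡-Reasoning
    1+j<n : suc j < n
    1+j<n = ≤-trans (s≤s (s≤s (m≤m+n j s))) (<⇒≤ i<n)
  parent-below zero s i<n | no falling = n ∸ 1 , n∸1<n , inj₁ wrap , (begin
    suc (cycDist (suc s) (n ∸ 1))      ≡⟨ cong suc (cycDist-to-last n≡) ⟩
    suc (r ⊓ suc (suc s))              ≡⟨ cong suc (m≤n⇒m⊓n≡m r≤2+s) ⟩
    suc r                              ≡⟨ sym n∸1+s≡1+r ⟩
    n ∸ suc s                          ≡⟨ sym (arc≡n∸ (<⇒≤ (≰⇒> falling))) ⟩
    cycDist (suc s) 0                  ∎)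
    where
    open ≡-Reasoning
    r : ℕ
    r = n ∸ suc (suc s)
    n≡ : n ≡ suc (suc s + r)
    n≡ = sym (m+[n∸m]≡n i<n)
    n∸1+s≡1+r : n ∸ suc s ≡ suc r
    n∸1+s≡1+r = trans (cong (_∸ suc s) n≡) (trans (cong (_∸ s) (sym (+-suc s r))) (m+n∸m≡n s (suc r)))
    r≤2+s : r ≤ suc (suc s)
    r≤2+s = ≤-trans (n≤1+n r) (≤-trans (subst (_≤ suc s) n∸1+s≡1+r (<⇒≤ (≰⇒> falling))) (n≤1+n (suc s)))
    n∸1<n : n ∸ 1 < n
    n∸1<n = ≤-reflexive (m+[n∸m]≡n (≤-trans (s≤s z≤n) i<n))

  cycDist-parent : ∀ {i j} → i < n → j < n → i ≢ j → CycleParent i j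
  cycDist-parent {i} {j} i<n j<n i≢j with <-cmp i j
  ... | tri≈ _ i≡j _ = ⊥-elim (i≢j i≡j)
  ... | tri< i<j _ _ with m≤n⇒∃[o]m+o≡n i<j
  ...   | s , refl = parent-above i s j<n
  cycDist-parent {i} {j} i<n j<n i≢j | tri> _ _ j<i with m≤n⇒∃[o]m+o≡n j<i
  ...   | s , refl = parent-below j s i<n

  arc-n∸ : ∀ {t} → t ≤ n → arc (n ∸ t) ≡ arc t
  arc-n∸ {t} t≤n = trans (cong ((n ∸ t) ⊓_) (m∸[m∸n]≡n t≤n)) (⊓-comm (n ∸ t) t)

  reflect : ℕ → ℕ
  reflect zero = 1
  reflect (suc zero) = 0
  reflect (suc (suc i)) = n ∸ suc i

  reflect-< : ∀ {i} → 1 < n → i < n → reflect i < n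
  reflect-< {zero} 1<n _ = 1<n
  reflect-< {suc zero} _ 1<n = <-trans (s≤s z≤n) 1<n
  reflect-< {suc (suc i)} _ 2+i<n = ∸-monoʳ-< {n} {suc i} {0} (s≤s z≤n) (≤-trans (n≤1+n (suc i)) (<⇒≤ 2+i<n))

  reflect-2+ : ∀ {i} → suc (suc i) < n → ∃ λ r → n ∸ suc i ≡ suc (suc r) × n ∸ suc (suc i) ≡ suc r
  reflect-2+ {i} 2+i<n = split (sym (m+[n∸m]≡n 2+i<n))
    where
    split : ∀ {r} → n ≡ suc (suc (suc i)) + r → ∃ λ r → n ∸ suc i ≡ suc (suc r) × n ∸ suc (suc i) ≡ suc r
    split {r} n≡ rewrite n≡ = r ,
      trans (cong (_∸ i) (cong suc (sym (+-suc i r)))) (trans (cong (_∸ i) (sym (+-suc i (suc r)))) (m+n∸m≡n i (suc (suc r)))) ,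
      trans (cong (_∸ i) (sym (+-suc i r))) (m+n∸m≡n i (suc r))

  reflect-involutive : ∀ {i} → i < n → reflect (reflect i) ≡ i
  reflect-involutive {zero} _ = refl
  reflect-involutive {suc zero} _ = refl
  reflect-involutive {suc (suc i)} 2+i<n with reflect-2+ 2+i<n
  ... | r , n∸[1+i]≡2+r , n∸[2+i]≡1+r = begin
    reflect (n ∸ suc i)    ≡⟨ cong reflect n∸[1+i]≡2+r ⟩
    n ∸ suc r              ≡⟨ cong (n ∸_) (sym n∸[2+i]≡1+r) ⟩
    n ∸ (n ∸ suc (suc i))  ≡⟨ m∸[m∸n]≡n (<⇒≤ 2+i<n) ⟩
    suc (suc i)            ∎
    where open ≡-Reasoning

  cycDist-1-reflect : ∀ {j} → j < n → cycDist 1 (reflect j) ≡ cycDist 0 j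
  cycDist-1-reflect {zero} _ = refl
  cycDist-1-reflect {suc zero} _ = cycDist-comm 1 0
  cycDist-1-reflect {suc (suc j)} 2+j<n with reflect-2+ 2+j<n
  ... | r , n∸[1+j]≡2+r , n∸[2+j]≡1+r =
    trans (cong (cycDist 1) n∸[1+j]≡2+r) (trans (cong arc (sym n∸[2+j]≡1+r)) (arc-n∸ (<⇒≤ 2+j<n)))

  cycDist-0-reflect : ∀ {j} → j < n → cycDist 0 (reflect j) ≡ cycDist 1 j
  cycDist-0-reflect {zero} _ = cycDist-comm 0 1
  cycDist-0-reflect {suc zero} _ = refl
  cycDist-0-reflect {suc (suc j)} 2+j<n = arc-n∸ (<⇒≤ (<-trans (n<1+n (suc j)) 2+j<n))

  cycDist-reflect : ∀ {i j} → i < n → j < n → cycDist (reflect i) (reflect j) ≡ cycDist i j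
  cycDist-reflect {zero} _ j<n = cycDist-1-reflect j<n
  cycDist-reflect {suc zero} _ j<n = cycDist-0-reflect j<n
  cycDist-reflect {suc (suc i)} {zero} 2+i<n _ =
    trans (cycDist-comm (n ∸ suc i) 1) (trans (cycDist-1-reflect 2+i<n) (cycDist-comm 0 (suc (suc i))))
  cycDist-reflect {suc (suc i)} {suc zero} 2+i<n _ =
    trans (cycDist-comm (n ∸ suc i) 0) (trans (cycDist-0-reflect 2+i<n) (cycDist-comm 1 (suc (suc i))))
  cycDist-reflect {suc (suc i)} {suc (suc j)} 2+i<n 2+j<n =
    cong arc (∣m∸n-m∸o∣≡∣n-o∣ n (<⇒≤ (<-trans (n<1+n _) 2+i<n)) (<⇒≤ (<-trans (n<1+n _) 2+j<n)))

-- The cuttlefish graph and its distance function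

-- n = 2k + p with k = ⌊n/2⌋ = a + 2 and p ∈ {0, 1}; the pendant paths have
-- m = k − 1 vertices, and D = m + k is the diameter of CF_n.
module Cuttlefish (n a p : ℕ) (n≡ : n ≡ suc (suc a) + suc (suc a) + p) (p≤1 : p ≤ 1) where

  open CycleDistance n public

  m k D : ℕ
  m = suc a
  k = suc m
  D = m + k

  -- U i, V i, W i are the paper's u_{i+1}, v_{i+1}, w_{i+1}; V a and W a are the
  -- tips of the pendant paths.
  data Vertex : Set where
    U V W : ℕ → Vertex

  Valid : Vertex → Set
  Valid (U i) = i < n
  Valid (V j) = j < m
  Valid (W j) = j < m

  dist : Vertex → Vertex → ℕ
  dist (U i) (U j) = cycDist i j
  dist (U i) (V j) = cycDist i 0 + suc j
  dist (U i) (W j) = cycDist i 1 + suc j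
  dist (V i) (U j) = suc i + cycDist 0 j
  dist (V i) (V j) = ∣ i - j ∣
  dist (V i) (W j) = suc (suc (suc (i + j)))
  dist (W i) (U j) = suc i + cycDist 1 j
  dist (W i) (V j) = suc (suc (suc (i + j)))
  dist (W i) (W j) = ∣ i - j ∣

  data Edge : Vertex → Vertex → Set where
    uu : ∀ {i j} → CycleAdj i j → Edge (U i) (U j)
    uv : Edge (U 0) (V 0)
    vv : ∀ {j} → suc j < m → Edge (V j) (V (suc j))
    uw : Edge (U 1) (W 0)
    ww : ∀ {j} → suc j < m → Edge (W j) (W (suc j))

  2≤k : 2 ≤ k
  2≤k = s≤s (s≤s z≤n)

  2k≤n : k + k ≤ n
  2k≤n = ≤-trans (m≤m+n (k + k) p) (≤-reflexive (sym n≡))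

  k<n : k < n
  k<n = ≤-trans (+-monoˡ-≤ k (≤-trans (s≤s z≤n) 2≤k)) 2k≤n

  0<n : 0 < n
  0<n = ≤-trans (s≤s z≤n) k<n

  1<n : 1 < n
  1<n = ≤-trans 2≤k (<⇒≤ k<n)

  n∸1<n : n ∸ 1 < n
  n∸1<n = ≤-reflexive (m+[n∸m]≡n 0<n)

  n∸k≡k+p : n ∸ k ≡ k + p
  n∸k≡k+p rewrite n≡ = trans (cong (_∸ k) (+-assoc k k p)) (m+n∸m≡n k (k + p))

  cycDist-self : ∀ i → cycDist i i ≡ 0
  cycDist-self i rewrite ∣n-n∣≡0 i = refl

  cycDist-0-1 : cycDist 0 1 ≡ 1
  cycDist-0-1 = m≤n⇒m⊓n≡m (∸-monoˡ-≤ 1 1<n)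

  dist-lipschitz : ∀ b {x y} → Valid b → Edge x y → Near (dist b y) (dist b x)
  dist-lipschitz (U i) b-valid (uu adj) = cycDist-adj b-valid adj
  dist-lipschitz (V i) _ (uu adj) = Near-+ˡ (suc i) (cycDist-adj 0<n adj)
  dist-lipschitz (W i) _ (uu adj) = Near-+ˡ (suc i) (cycDist-adj 1<n adj)
  dist-lipschitz (U i) _ uv = subst (λ x → Near x (cycDist i 0)) (+-comm 1 (cycDist i 0)) (Near-suc _)
  dist-lipschitz (V i) _ uv = subst₂ Near (sym (∣-∣-identityʳ i)) (sym (+-identityʳ (suc i))) (swap (Near-suc i))
  dist-lipschitz (W i) _ uv rewrite cycDist-0-1 | +-identityʳ i | +-comm i 1 = Near-suc (suc (suc i))
  dist-lipschitz (U i) _ (vv _) = Near-+ˡ (cycDist i 0) (Near-suc _)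
  dist-lipschitz (V i) _ (vv {j} _) = ∣m-n∣-Near i j
  dist-lipschitz (W i) _ (vv {j} _) rewrite +-suc i j = Near-suc (suc (suc (suc (i + j))))
  dist-lipschitz (U i) _ uw = subst (λ x → Near x (cycDist i 1)) (+-comm 1 (cycDist i 1)) (Near-suc _)
  dist-lipschitz (V i) _ uw rewrite cycDist-0-1 | +-identityʳ i | +-comm i 1 = Near-suc (suc (suc i))
  dist-lipschitz (W i) _ uw = subst₂ Near (sym (∣-∣-identityʳ i)) (sym (+-identityʳ (suc i))) (swap (Near-suc i))
  dist-lipschitz (U i) _ (ww _) = Near-+ˡ (cycDist i 1) (Near-suc _)
  dist-lipschitz (V i) _ (ww {j} _) rewrite +-suc i j = Near-suc (suc (suc (suc (i + j))))
  dist-lipschitz (W i) _ (ww {j} _) = ∣m-n∣-Near i j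

  Parent : Vertex → Vertex → ℕ → Set
  Parent b y t = ∃ λ y' → Valid y' × (Edge y' y ⊎ Edge y y') × dist b y' ≡ t

  lift-cycle-parent : ∀ b o c {j t} → (∀ j → dist b (U j) ≡ c + cycDist o j) →
    CycleParent o j → dist b (U j) ≡ suc t → Parent b (U j) t
  lift-cycle-parent b o c {j} {t} dist≡ (j' , j'<n , adj , parent≡) b-to-j≡ =
    U j' , j'<n , Data.Sum.map uu uu adj , suc-injective (begin
      suc (dist b (U j'))      ≡⟨ cong suc (dist≡ j') ⟩
      suc (c + cycDist o j')   ≡⟨ sym (+-suc c _) ⟩
      c + suc (cycDist o j')   ≡⟨ cong (c +_) parent≡ ⟩
      c + cycDist o j          ≡⟨ sym (dist≡ j) ⟩
      dist b (U j)             ≡⟨ b-to-j≡ ⟩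
      suc t                    ∎)
    where open ≡-Reasoning

  dist-parent : ∀ b y {t} → Valid b → Valid y → dist b y ≡ suc t → Parent b y t
  dist-parent (V i) (V j) i<m j<m e with ∣m-n∣-step i j e
  ... | inj₁ (j' , refl , e') = V j' , <-trans (n<1+n j') j<m , inj₁ (vv j<m) , e'
  ... | inj₂ (1+j≤i , e') = V (suc j) , ≤-<-trans 1+j≤i i<m , inj₂ (vv (≤-<-trans 1+j≤i i<m)) , e'
  dist-parent (W i) (W j) i<m j<m e with ∣m-n∣-step i j e
  ... | inj₁ (j' , refl , e') = W j' , <-trans (n<1+n j') j<m , inj₁ (ww j<m) , e'
  ... | inj₂ (1+j≤i , e') = W (suc j) , ≤-<-trans 1+j≤i i<m , inj₂ (ww (≤-<-trans 1+j≤i i<m)) , e'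
  dist-parent (U i) (V zero) _ _ e = U 0 , 0<n , inj₁ uv , suc-injective (trans (+-comm 1 (cycDist i 0)) e)
  dist-parent (U i) (V (suc j)) _ j<m e = V j , <-trans (n<1+n j) j<m , inj₁ (vv j<m) , suc-injective (trans (sym (+-suc (cycDist i 0) (suc j))) e)
  dist-parent (U i) (W zero) _ _ e = U 1 , 1<n , inj₁ uw , suc-injective (trans (+-comm 1 (cycDist i 1)) e)
  dist-parent (U i) (W (suc j)) _ j<m e = W j , <-trans (n<1+n j) j<m , inj₁ (ww j<m) , suc-injective (trans (sym (+-suc (cycDist i 1) (suc j))) e)
  dist-parent (W i) (V zero) _ _ e = U 0 , 0<n , inj₁ uv ,
    trans (cong (suc i +_) cycDist-0-1) (trans (+-comm (suc i) 1) (trans (cong (suc ∘ suc) (sym (+-identityʳ i))) (suc-injective e)))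
  dist-parent (W i) (V (suc j)) _ j<m e = V j , <-trans (n<1+n j) j<m , inj₁ (vv j<m) , trans (cong (suc ∘ suc) (sym (+-suc i j))) (suc-injective e)
  dist-parent (V i) (W zero) _ _ e = U 1 , 1<n , inj₁ uw ,
    trans (cong (suc i +_) cycDist-0-1) (trans (+-comm (suc i) 1) (trans (cong (suc ∘ suc) (sym (+-identityʳ i))) (suc-injective e)))
  dist-parent (V i) (W (suc j)) _ j<m e = W j , <-trans (n<1+n j) j<m , inj₁ (ww j<m) , trans (cong (suc ∘ suc) (sym (+-suc i j))) (suc-injective e)
  dist-parent (U i) (U j) i<n j<n e with i ≟ j
  ... | yes refl = ⊥-elim (0≢1+n (trans (sym (cycDist-self i)) e))
  ... | no i≢j = lift-cycle-parent (U i) i 0 (λ _ → refl) (cycDist-parent i<n j<n i≢j) e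
  dist-parent (V i) (U zero) i<m _ e = V 0 , ≤-trans (s≤s z≤n) i<m , inj₂ uv , trans (∣-∣-identityʳ i) (trans (sym (+-identityʳ i)) (suc-injective e))
  dist-parent (V i) (U (suc j)) _ j<n e = lift-cycle-parent (V i) 0 (suc i) (λ _ → refl) (cycDist-parent 0<n j<n (λ ())) e
  dist-parent (W i) (U j) i<m j<n e with 1 ≟ j
  ... | yes refl = W 0 , ≤-trans (s≤s z≤n) i<m , inj₂ uw , trans (∣-∣-identityʳ i) (trans (sym (+-identityʳ i)) (suc-injective e))
  ... | no 1≢j = lift-cycle-parent (W i) 1 (suc i) (λ _ → refl) (cycDist-parent 1<n j<n 1≢j) e

  dist-self : ∀ b → dist b b ≡ 0
  dist-self (U i) = cycDist-self i
  dist-self (V i) = ∣n-n∣≡0 i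
  dist-self (W i) = ∣n-n∣≡0 i

  dist≡0⇒≡ : ∀ b y → Valid b → Valid y → dist b y ≡ 0 → y ≡ b
  dist≡0⇒≡ (U i) (U j) i<n j<n e = cong U (sym (∣m-n∣≡0⇒m≡n (arc≡0⇒≡0 ∣i-j∣<n e)))
    where
    ∣i-j∣<n : ∣ i - j ∣ < n
    ∣i-j∣<n = ≤-<-trans (∣m-n∣≤m⊔n i j) (⊔-lub i<n j<n)
  dist≡0⇒≡ (V i) (V j) _ _ e = cong V (sym (∣m-n∣≡0⇒m≡n e))
  dist≡0⇒≡ (W i) (W j) _ _ e = cong W (sym (∣m-n∣≡0⇒m≡n e))
  dist≡0⇒≡ (U i) (V j) _ _ e = ⊥-elim (0≢1+n (sym (trans (sym (+-suc (cycDist i 0) j)) e)))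
  dist≡0⇒≡ (U i) (W j) _ _ e = ⊥-elim (0≢1+n (sym (trans (sym (+-suc (cycDist i 1) j)) e)))
  dist≡0⇒≡ (V _) (U _) _ _ ()
  dist≡0⇒≡ (V _) (W _) _ _ ()
  dist≡0⇒≡ (W _) (U _) _ _ ()
  dist≡0⇒≡ (W _) (V _) _ _ ()

module CuttlefishGeometry (n a p : ℕ) (n≡ : n ≡ suc (suc a) + suc (suc a) + p) (p≤1 : p ≤ 1) where

  open Cuttlefish n a p n≡ p≤1 public

  k<D : k < D
  k<D = s≤s (m≤n+m k a)

  m<D : m < D
  m<D = <-trans (n<1+n m) k<D

  arc≤k : ∀ t → arc t ≤ k
  arc≤k t with t ≤? k
  ... | yes t≤k = ≤-trans (arc≤ t) t≤k
  ... | no t≰k = ≤-trans (arc≤n∸ t) (m≤n+o⇒m∸n≤o n t (subst (_≤ t + k) (sym n≡) 2k+p≤t+k))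
    where
    2k+p≤t+k : k + k + p ≤ t + k
    2k+p≤t+k = begin
      k + k + p    ≡⟨ trans (+-assoc k k p) (+-comm k (k + p)) ⟩
      k + p + k    ≤⟨ +-monoˡ-≤ k (+-monoʳ-≤ k p≤1) ⟩
      k + 1 + k    ≡⟨ cong (_+ k) (+-comm k 1) ⟩
      suc k + k    ≤⟨ +-monoˡ-≤ k (≰⇒> t≰k) ⟩
      t + k        ∎
      where open ≤-Reasoning

  cycDist≤k : ∀ i j → cycDist i j ≤ k
  cycDist≤k i j = arc≤k _

  t≤k⇒arc≡t : ∀ {t} → t ≤ k → arc t ≡ t
  t≤k⇒arc≡t {t} t≤k = arc≡ (≤-trans t≤k (≤-trans (≤-trans (m≤m+n k p) (≤-reflexive (sym n∸k≡k+p))) (∸-monoʳ-≤ n t≤k)))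

  arc≡k⇒ : ∀ {t} → t < n → arc t ≡ k → t ≡ k ⊎ (p ≡ 1 × t ≡ suc k)
  arc≡k⇒ {t} t<n e with ⊓-sel t (n ∸ t)
  ... | inj₁ arc≡t = inj₁ (trans (sym arc≡t) e)
  ... | inj₂ arc≡n∸t = by-parity (trans (sym (m∸[m∸n]≡n (<⇒≤ t<n))) (trans (cong (n ∸_) (trans (sym arc≡n∸t) e)) n∸k≡k+p))
    where
    by-parity : t ≡ k + p → t ≡ k ⊎ (p ≡ 1 × t ≡ suc k)
    by-parity t≡k+p with ≤1⇒≡0⊎≡1 p≤1
    ... | inj₁ refl = inj₁ (trans t≡k+p (+-identityʳ k))
    ... | inj₂ refl = inj₂ (refl , trans t≡k+p (+-comm k 1))

  arc-k : arc k ≡ k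
  arc-k = t≤k⇒arc≡t ≤-refl

  cycDist≡0⇒≡0 : ∀ {j} → j < n → cycDist j 0 ≡ 0 → j ≡ 0
  cycDist≡0⇒≡0 {j} j<n e = arc≡0⇒≡0 j<n (trans (sym (cycDist-comm j 0)) e)

  4≤n : 4 ≤ n
  4≤n = ≤-trans (+-mono-≤ 2≤k 2≤k) 2k≤n

  cycDist-0≡1⇒≡1 : ∀ {j} → j < n → cycDist j 0 ≡ 1 → cycDist j 1 ≤ 1 → j ≡ 1
  cycDist-0≡1⇒≡1 {j} j<n d₀ d₁ with ⊓-sel j (n ∸ j)
  ... | inj₁ arc≡j = trans (sym arc≡j) (trans (cycDist-comm 0 j) d₀)
  ... | inj₂ arc≡n∸j = ⊥-elim (impossible j<n (trans (sym arc≡n∸j) (trans (cycDist-comm 0 j) d₀)) (subst (_≤ 1) (cycDist-comm j 1) d₁))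
    where
    impossible : ∀ {j} → j < n → n ∸ j ≡ 1 → cycDist 1 j ≤ 1 → ⊥
    impossible {zero} _ n≡1 _ = <⇒≢ (≤-trans (s≤s (s≤s z≤n)) 4≤n) (sym n≡1)
    impossible {suc j} 1+j<n n∸1+j≡1 d≤1 = <⇒≱ (s≤s (s≤s z≤n)) (≤-trans (⊓-glb 2≤j (≤-reflexive (sym n∸j≡2))) d≤1)
      where
      n∸j≡2 : n ∸ j ≡ 2
      n∸j≡2 = trans (+-∸-assoc 1 (<⇒≤ 1+j<n)) (cong suc n∸1+j≡1)
      2≤j : 2 ≤ j
      2≤j = +-cancelʳ-≤ 2 2 j (≤-trans 4≤n (≤-reflexive (sym (trans (cong (j +_) (sym n∸j≡2)) (m+[n∸m]≡n (<⇒≤ (<-trans (n<1+n j) 1+j<n)))))))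

  IsTip : Vertex → Set
  IsTip y = y ≡ V a ⊎ y ≡ W a

  FacesTips : Vertex → Set
  FacesTips y = (∃ λ y' → Valid y' × dist y y' ≡ D) × (∀ y' → Valid y' → dist y y' ≡ D → IsTip y')

  path-end : ∀ {x i} → x ≤ k → i < m → x + suc i ≡ D → i ≡ a
  path-end {x} {i} x≤k i<m e = suc-injective (proj₂ (+-tight x≤k i<m (trans e (+-comm m k))))

  cycle-faces-tips : ∀ {j} → cycDist j 0 ≡ k ⊎ cycDist j 1 ≡ k → FacesTips (U j)
  cycle-faces-tips {j} far = antipode far , only-tips
    where
    antipode : cycDist j 0 ≡ k ⊎ cycDist j 1 ≡ k → ∃ λ y → Valid y × dist (U j) y ≡ D
    antipode (inj₁ e) = V a , ≤-refl , trans (cong (_+ m) e) (+-comm k m)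
    antipode (inj₂ e) = W a , ≤-refl , trans (cong (_+ m) e) (+-comm k m)
    only-tips : ∀ y → Valid y → dist (U j) y ≡ D → IsTip y
    only-tips (U j') _ e = ⊥-elim (<⇒≢ (≤-<-trans (cycDist≤k j j') k<D) e)
    only-tips (V i) i<m e = inj₁ (cong V (path-end (cycDist≤k j 0) i<m e))
    only-tips (W i) i<m e = inj₂ (cong W (path-end (cycDist≤k j 1) i<m e))

  ∣m-n∣<m : ∀ {i j} → i < m → j < m → ∣ i - j ∣ < m
  ∣m-n∣<m {i} {j} i<m j<m = ≤-<-trans (∣m-n∣≤m⊔n i j) (⊔-lub i<m j<m)

  tip-to-tip : ∀ i → suc (suc (suc (i + a))) ≡ suc i + k
  tip-to-tip i = cong suc (sym (trans (+-suc i (suc a)) (cong suc (+-suc i a))))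

  across≡⇒tip : ∀ {i j} → suc (suc (suc (i + j))) ≡ suc i + k → j ≡ a
  across≡⇒tip {i} {j} e = +-cancelˡ-≡ i j a (suc-injective (suc-injective (suc-injective (trans e (sym (tip-to-tip i))))))

  TipOrFacing : Vertex → Set
  TipOrFacing y = IsTip y ⊎ FacesTips y

  eccentric-move : ∀ u → Valid u →
    ∃ λ e → (∃ λ y → Valid y × dist u y ≡ e) × (∀ y → Valid y → dist u y ≡ e → TipOrFacing y)
  eccentric-move (V i) i<m = suc i + k , (W a , ≤-refl , tip-to-tip i) , lands
    where
    lands : ∀ y → Valid y → dist (V i) y ≡ suc i + k → TipOrFacing y
    lands (U j) _ e = inj₂ (cycle-faces-tips (inj₁ (trans (cycDist-comm j 0) (+-cancelˡ-≡ (suc i) _ _ e))))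
    lands (V j) j<m e = ⊥-elim (<⇒≢ (<-trans (∣m-n∣<m i<m j<m) (≤-trans (n<1+n m) (m≤n+m k (suc i)))) e)
    lands (W j) _ e = inj₁ (inj₂ (cong W (across≡⇒tip e)))
  eccentric-move (W i) i<m = suc i + k , (V a , ≤-refl , tip-to-tip i) , lands
    where
    lands : ∀ y → Valid y → dist (W i) y ≡ suc i + k → TipOrFacing y
    lands (U j) _ e = inj₂ (cycle-faces-tips (inj₂ (trans (cycDist-comm j 1) (+-cancelˡ-≡ (suc i) _ _ e))))
    lands (W j) j<m e = ⊥-elim (<⇒≢ (<-trans (∣m-n∣<m i<m j<m) (≤-trans (n<1+n m) (m≤n+m k (suc i)))) e)
    lands (V j) _ e = inj₁ (inj₁ (cong V (across≡⇒tip e)))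
  eccentric-move (U j) j<n with cycDist j 1 ≤? cycDist j 0
  ... | yes d₁≤d₀ = cycDist j 0 + m , (V a , ≤-refl , refl) , lands
    where
    lands : ∀ y → Valid y → dist (U j) y ≡ cycDist j 0 + m → TipOrFacing y
    lands (V i) _ e = inj₁ (inj₁ (cong V (suc-injective (+-cancelˡ-≡ (cycDist j 0) _ _ e))))
    lands (W i) i<m e = inj₁ (inj₂ (cong W (suc-injective (proj₂ (+-tight d₁≤d₀ i<m e)))))
    lands (U j') _ e = inj₂ (cycle-faces-tips (inj₂ (trans (cycDist-comm j' 1) (subst (λ z → cycDist z j' ≡ k) j≡1 (trans e (cong (_+ m) d₀≡1))))))
      where
      d₀≤1 : cycDist j 0 ≤ 1
      d₀≤1 = +-cancelʳ-≤ m (cycDist j 0) 1 (≤-trans (≤-reflexive (sym e)) (cycDist≤k j j'))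
      d₀≡1 : cycDist j 0 ≡ 1
      d₀≡1 with m≤n⇒m<n∨m≡n d₀≤1
      ... | inj₂ d₀≡1 = d₀≡1
      ... | inj₁ (s≤s d₀≤0) with cycDist≡0⇒≡0 j<n (n≤0⇒n≡0 d₀≤0)
      ...   | refl = ⊥-elim (<⇒≱ (≤-reflexive (sym cycDist-0-1)) (≤-trans d₁≤d₀ d₀≤0))
      j≡1 : j ≡ 1
      j≡1 = cycDist-0≡1⇒≡1 j<n d₀≡1 (≤-trans d₁≤d₀ (≤-reflexive d₀≡1))
  ... | no d₁≰d₀ = cycDist j 1 + m , (W a , ≤-refl , refl) , lands
    where
    lands : ∀ y → Valid y → dist (U j) y ≡ cycDist j 1 + m → TipOrFacing y
    lands (W i) _ e = inj₁ (inj₂ (cong W (suc-injective (+-cancelˡ-≡ (cycDist j 1) _ _ e))))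
    lands (V i) i<m e = ⊥-elim (<⇒≢ (+-mono-<-≤ (≰⇒> d₁≰d₀) i<m) e)
    lands (U j') _ e = inj₂ (cycle-faces-tips (inj₁ (trans (cycDist-comm j' 0) (subst (λ z → cycDist z j' ≡ k) j≡0 (trans e (cong (_+ m) d₁≡1))))))
      where
      d₁≤1 : cycDist j 1 ≤ 1
      d₁≤1 = +-cancelʳ-≤ m (cycDist j 1) 1 (≤-trans (≤-reflexive (sym e)) (cycDist≤k j j'))
      j≡0 : j ≡ 0
      j≡0 = cycDist≡0⇒≡0 j<n (n≤0⇒n≡0 (s≤s⁻¹ (≤-trans (≰⇒> d₁≰d₀) d₁≤1)))
      d₁≡1 : cycDist j 1 ≡ 1
      d₁≡1 = trans (cong (λ z → cycDist z 1) j≡0) cycDist-0-1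

  -- the geodesic V a, …, V 0, U 0, …, U k of length D, indexed by position
  spine : ℕ → Vertex
  spine q with q <? m
  ... | yes _ = V (a ∸ q)
  ... | no _ = U (q ∸ m)

  data OnSpine : ℕ → Vertex → Set where
    on-path : ∀ {q} → q ≤ a → OnSpine q (V (a ∸ q))
    on-cycle : ∀ {i} → i ≤ k → OnSpine (m + i) (U i)

  spine-path : ∀ {q} → q < m → spine q ≡ V (a ∸ q)
  spine-path {q} q<m with q <? m
  ... | yes _ = refl
  ... | no q≮m = ⊥-elim (q≮m q<m)

  spine-cycle : ∀ i → spine (m + i) ≡ U i
  spine-cycle i with m + i <? m
  ... | yes m+i<m = ⊥-elim (<⇒≱ m+i<m (m≤m+n m i))
  ... | no _ = cong U (m+n∸m≡n m i)

  on-spine : ∀ {q} → q < k + k → OnSpine q (spine q)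
  on-spine {q} q<2k with q <? m
  ... | yes q<m = on-path (s≤s⁻¹ q<m)
  ... | no q≮m = subst (λ q' → OnSpine q' (U (q ∸ m))) (m+[n∸m]≡n (≮⇒≥ q≮m)) (on-cycle (m≤n+o⇒m∸n≤o q m (s≤s⁻¹ q<2k)))

  OnSpine-valid : ∀ {q x} → OnSpine q x → Valid x
  OnSpine-valid (on-path {q} _) = s≤s (m∸n≤m a q)
  OnSpine-valid (on-cycle i≤k) = ≤-<-trans i≤k k<n

  spine-valid : ∀ {q} → q < k + k → Valid (spine q)
  spine-valid q<2k = OnSpine-valid (on-spine q<2k)

  spine-isometric : ∀ {q q' x y} → OnSpine q x → OnSpine q' y → dist x y ≡ ∣ q - q' ∣
  spine-isometric (on-path q≤a) (on-path q'≤a) = ∣m∸n-m∸o∣≡∣n-o∣ a q≤a q'≤a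
  spine-isometric (on-path {q} q≤a) (on-cycle {i} i≤k) =
    trans (cong (suc (a ∸ q) +_) (t≤k⇒arc≡t i≤k)) (sym (∣q-1+a+i∣≡1+[a∸q]+i i q≤a))
  spine-isometric (on-cycle {i} i≤k) (on-path {q'} q'≤a) = begin
    cycDist i 0 + suc (a ∸ q')    ≡⟨ cong (_+ suc (a ∸ q')) (trans (cycDist-comm i 0) (t≤k⇒arc≡t i≤k)) ⟩
    i + suc (a ∸ q')              ≡⟨ +-comm i _ ⟩
    suc (a ∸ q') + i              ≡⟨ sym (∣q-1+a+i∣≡1+[a∸q]+i i q'≤a) ⟩
    ∣ q' - m + i ∣                ≡⟨ ∣-∣-comm q' (m + i) ⟩
    ∣ m + i - q' ∣                ∎
    where open ≡-Reasoning
  spine-isometric (on-cycle {i} i≤k) (on-cycle {i'} i'≤k) =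
    trans (t≤k⇒arc≡t (≤-trans (∣m-n∣≤m⊔n i i') (⊔-lub i≤k i'≤k))) (sym (∣m+n-m+o∣≡∣n-o∣ m i i'))

  2+a+a≡D : suc (suc (suc (a + a))) ≡ D
  2+a+a≡D = cong suc (trans (cong suc (sym (+-suc a a))) (sym (+-suc a (suc a))))

  U0-within-k : ∀ y → Valid y → dist (U 0) y ≤ k
  U0-within-k (U j) _ = cycDist≤k 0 j
  U0-within-k (V j) j<m = ≤-trans j<m (n≤1+n m)
  U0-within-k (W j) j<m = ≤-trans (≤-reflexive (cong (_+ suc j) cycDist-0-1)) (s≤s j<m)

  spine-short : ∀ {q x} → OnSpine q x → ∀ y → Valid y → dist x y ≤ q ⊎ q + dist x y ≤ D
  spine-short (on-path {q} q≤a) (U j) _ = inj₂ (begin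
    q + (suc (a ∸ q) + arc j)    ≤⟨ +-monoʳ-≤ q (+-monoʳ-≤ (suc (a ∸ q)) (arc≤k j)) ⟩
    q + (suc (a ∸ q) + k)        ≡⟨ sym (+-assoc q (suc (a ∸ q)) k) ⟩
    q + suc (a ∸ q) + k          ≡⟨ cong (_+ k) (trans (+-suc q (a ∸ q)) (cong suc (m+[n∸m]≡n q≤a))) ⟩
    D                            ∎)
    where open ≤-Reasoning
  spine-short (on-path {q} q≤a) (V j) j<m = inj₂ (begin
    q + ∣ a ∸ q - j ∣            ≤⟨ +-mono-≤ q≤a (≤-trans (∣m-n∣≤m⊔n (a ∸ q) j) (⊔-lub (m∸n≤m a q) (s≤s⁻¹ j<m))) ⟩
    a + a                        ≤⟨ m≤n+m (a + a) 3 ⟩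
    suc (suc (suc (a + a)))      ≡⟨ 2+a+a≡D ⟩
    D                            ∎)
    where open ≤-Reasoning
  spine-short (on-path {q} q≤a) (W j) j<m = inj₂ (begin
    q + suc (suc (suc (a ∸ q + j)))   ≤⟨ +-monoʳ-≤ q (s≤s (s≤s (s≤s (+-monoʳ-≤ (a ∸ q) (s≤s⁻¹ j<m))))) ⟩
    q + suc (suc (suc (a ∸ q + a)))   ≡⟨ +-suc q _ ⟩
    suc (q + suc (suc (a ∸ q + a)))   ≡⟨ cong suc (+-suc q _) ⟩
    suc (suc (q + suc (a ∸ q + a)))   ≡⟨ cong (suc ∘ suc) (+-suc q _) ⟩
    suc (suc (suc (q + (a ∸ q + a)))) ≡⟨ cong (suc ∘ suc ∘ suc) (trans (sym (+-assoc q (a ∸ q) a)) (cong (_+ a) (m+[n∸m]≡n q≤a))) ⟩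
    suc (suc (suc (a + a)))           ≡⟨ 2+a+a≡D ⟩
    D                                 ∎)
    where open ≤-Reasoning
  spine-short (on-cycle {zero} _) y y-valid = inj₂ (subst (λ x → x + dist (U 0) y ≤ D) (sym (+-identityʳ m)) (+-monoʳ-≤ m (U0-within-k y y-valid)))
  spine-short (on-cycle {suc i} _) y y-valid = inj₁ (back y y-valid)
    where
    back : ∀ y → Valid y → dist (U (suc i)) y ≤ m + suc i
    back (U j) _ = ≤-trans (cycDist≤k (suc i) j) (≤-trans (≤-reflexive (+-comm 1 m)) (+-monoʳ-≤ m (s≤s z≤n)))
    back (V j) j<m = ≤-trans (+-mono-≤ (≤-trans (≤-reflexive (cycDist-comm (suc i) 0)) (arc≤ (suc i))) j<m) (≤-reflexive (+-comm (suc i) m))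
    back (W j) j<m = ≤-trans (+-mono-≤ (≤-trans (≤-reflexive (cycDist-comm (suc i) 1)) (≤-trans (arc≤ i) (n≤1+n i))) j<m) (≤-reflexive (+-comm (suc i) m))

  mirror : Vertex → Vertex
  mirror (U i) = U (reflect i)
  mirror (V j) = W j
  mirror (W j) = V j

  mirror-valid : ∀ {t} → Valid t → Valid (mirror t)
  mirror-valid {U i} i<n = reflect-< 1<n i<n
  mirror-valid {V j} j<m = j<m
  mirror-valid {W j} j<m = j<m

  mirror-involutive : ∀ {t} → Valid t → mirror (mirror t) ≡ t
  mirror-involutive {U i} i<n = cong U (reflect-involutive i<n)
  mirror-involutive {V j} _ = refl
  mirror-involutive {W j} _ = refl

  mirror-isometric : ∀ x y → Valid x → Valid y → dist (mirror x) (mirror y) ≡ dist x y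
  mirror-isometric (U i) (U j) i<n j<n = cycDist-reflect i<n j<n
  mirror-isometric (U i) (V j) i<n _ = cong (_+ suc j) (cycDist-reflect i<n 0<n)
  mirror-isometric (U i) (W j) i<n _ = cong (_+ suc j) (cycDist-reflect i<n 1<n)
  mirror-isometric (V i) (U j) _ j<n = cong (suc i +_) (cycDist-reflect 0<n j<n)
  mirror-isometric (W i) (U j) _ j<n = cong (suc i +_) (cycDist-reflect 1<n j<n)
  mirror-isometric (V i) (V j) _ _ = refl
  mirror-isometric (V i) (W j) _ _ = refl
  mirror-isometric (W i) (V j) _ _ = refl
  mirror-isometric (W i) (W j) _ _ = refl

  a∸j<2k : ∀ j → a ∸ j < k + k
  a∸j<2k j = ≤-trans (s≤s (m∸n≤m a j)) (≤-trans (n≤1+n m) (m≤m+n k k))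

  m+i<2k : ∀ {i} → i ≤ k → m + i < k + k
  m+i<2k i≤k = s≤s (+-monoʳ-≤ m i≤k)

  reflect-far≤k : ∀ i → i ≰ k → (p ≡ 1 → U i ≢ U (suc k)) → reflect i ≤ k
  reflect-far≤k zero i≰k _ = ⊥-elim (i≰k z≤n)
  reflect-far≤k (suc zero) i≰k _ = ⊥-elim (i≰k (s≤s z≤n))
  reflect-far≤k (suc (suc i)) i≰k not-special = m≤n+o⇒m∸n≤o n (suc i) (begin
    n                  ≡⟨ n≡ ⟩
    k + k + p          ≡⟨ trans (+-assoc k k p) (+-comm k (k + p)) ⟩
    k + p + k          ≤⟨ +-monoˡ-≤ k k+p≤1+i ⟩
    suc i + k          ∎)
    where
    open ≤-Reasoning
    k+p≤1+i : k + p ≤ suc i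
    k+p≤1+i with ≤1⇒≡0⊎≡1 p≤1 | m≤n⇒m<n∨m≡n (≰⇒> i≰k)
    ... | inj₁ refl | _ = ≤-trans (≤-reflexive (+-identityʳ k)) (s≤s⁻¹ (≰⇒> i≰k))
    ... | inj₂ p≡1 | inj₂ 1+k≡2+i = ⊥-elim (not-special p≡1 (cong U (sym 1+k≡2+i)))
    ... | inj₂ refl | inj₁ 1+k<2+i = ≤-trans (≤-reflexive (+-comm k 1)) (s≤s⁻¹ 1+k<2+i)

  spine-or-mirror : ∀ t → Valid t → (p ≡ 1 → t ≢ U (suc k)) →
    (∃ λ q → q < k + k × spine q ≡ t) ⊎ (∃ λ q → q < k + k × mirror (spine q) ≡ t)
  spine-or-mirror (V j) j<m _ = inj₁ (a ∸ j , a∸j<2k j , trans (spine-path (s≤s (m∸n≤m a j))) (cong V (m∸[m∸n]≡n (s≤s⁻¹ j<m))))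
  spine-or-mirror (W j) j<m _ = inj₂ (a ∸ j , a∸j<2k j , trans (cong mirror (spine-path (s≤s (m∸n≤m a j)))) (cong W (m∸[m∸n]≡n (s≤s⁻¹ j<m))))
  spine-or-mirror (U i) i<n not-special with i ≤? k
  ... | yes i≤k = inj₁ (m + i , m+i<2k i≤k , spine-cycle i)
  ... | no i≰k = inj₂ (m + reflect i , m+i<2k (reflect-far≤k i i≰k not-special) , (begin
    mirror (spine (m + reflect i))    ≡⟨ cong mirror (spine-cycle (reflect i)) ⟩
    U (reflect (reflect i))           ≡⟨ cong U (reflect-involutive i<n) ⟩
    U i                               ∎))
    where open ≡-Reasoning

  dist≤D : ∀ x y → Valid x → Valid y → dist x y ≤ D
  dist≤D (U i) (U j) _ _ = ≤-trans (cycDist≤k i j) (<⇒≤ k<D)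
  dist≤D (U i) (V j) _ j<m = ≤-trans (+-mono-≤ (cycDist≤k i 0) j<m) (≤-reflexive (+-comm k m))
  dist≤D (U i) (W j) _ j<m = ≤-trans (+-mono-≤ (cycDist≤k i 1) j<m) (≤-reflexive (+-comm k m))
  dist≤D (V i) (U j) i<m _ = +-mono-≤ i<m (cycDist≤k 0 j)
  dist≤D (W i) (U j) i<m _ = +-mono-≤ i<m (cycDist≤k 1 j)
  dist≤D (V i) (V j) i<m j<m = <⇒≤ (<-trans (∣m-n∣<m i<m j<m) m<D)
  dist≤D (W i) (W j) i<m j<m = <⇒≤ (<-trans (∣m-n∣<m i<m j<m) m<D)
  dist≤D (V i) (W j) i<m j<m = ≤-trans (s≤s (s≤s (s≤s (+-mono-≤ (s≤s⁻¹ i<m) (s≤s⁻¹ j<m))))) (≤-reflexive 2+a+a≡D)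
  dist≤D (W i) (V j) i<m j<m = ≤-trans (s≤s (s≤s (s≤s (+-mono-≤ (s≤s⁻¹ i<m) (s≤s⁻¹ j<m))))) (≤-reflexive 2+a+a≡D)

  module Odd (p≡1 : p ≡ 1) where

    n∸1+k≡k : n ∸ suc k ≡ k
    n∸1+k≡k = begin
      n ∸ suc k          ≡⟨ sym (pred[m∸n]≡m∸[1+n] n k) ⟩
      pred (n ∸ k)       ≡⟨ cong pred n∸k≡k+p ⟩
      pred (k + p)       ≡⟨ cong (pred ∘ (k +_)) p≡1 ⟩
      pred (k + 1)       ≡⟨ cong pred (+-comm k 1) ⟩
      k                  ∎
      where open ≡-Reasoning

    arc-1+k : arc (suc k) ≡ k
    arc-1+k = trans (arc≡n∸ (≤-trans (≤-reflexive n∸1+k≡k) (n≤1+n k))) n∸1+k≡k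


    n≡1+k+k : n ≡ suc k + k
    n≡1+k+k = trans n≡ (trans (cong (k + k +_) p≡1) (+-comm (k + k) 1))

    1+k<n : suc k < n
    1+k<n = subst (suc (suc k) ≤_) (sym n≡1+k+k) (s≤s (≤-trans (≤-reflexive (+-comm 1 k)) (+-monoʳ-≤ k (≤-trans (s≤s z≤n) 2≤k))))

    2+k<n : suc (suc k) < n
    2+k<n = subst (suc (suc (suc k)) ≤_) (sym n≡1+k+k) (s≤s (≤-trans (≤-reflexive (+-comm 2 k)) (+-monoʳ-≤ k 2≤k)))

    k+m≡D : ∀ {x} → x ≡ k → x + m ≡ D
    k+m≡D x≡k = trans (cong (_+ m) x≡k) (+-comm k m)

    V-tip-to-U1+k : dist (V a) (U (suc k)) ≡ D
    V-tip-to-U1+k = cong (suc a +_) arc-1+k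

    V-tip-to-Uk : dist (V a) (U k) ≡ D
    V-tip-to-Uk = cong (suc a +_) arc-k

    W-tip-to-U1+k : dist (W a) (U (suc k)) ≡ D
    W-tip-to-U1+k = cong (suc a +_) arc-k

    W-tip-to-U2+k : dist (W a) (U (suc (suc k))) ≡ D
    W-tip-to-U2+k = cong (suc a +_) arc-1+k

    U1+k-to-Uk : dist (U (suc k)) (U k) ≡ 1
    U1+k-to-Uk = trans (cong arc (∣1+m-m∣≡1 k)) cycDist-0-1

    U2+k-to-W-tip : dist (U (suc (suc k))) (W a) ≡ D
    U2+k-to-W-tip = k+m≡D (trans (cycDist-comm (suc (suc k)) 1) arc-1+k)

    Uk-to-V-tip : dist (U k) (V a) ≡ D
    Uk-to-V-tip = k+m≡D (trans (cycDist-comm k 0) arc-k)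

    V-tip-antipodes : ∀ y → Valid y → dist (V a) y ≡ D → y ≡ U k ⊎ y ≡ U (suc k) ⊎ y ≡ W a
    V-tip-antipodes (U j) j<n e with arc≡k⇒ j<n (+-cancelˡ-≡ (suc a) _ _ e)
    ... | inj₁ j≡k = inj₁ (cong U j≡k)
    ... | inj₂ (_ , j≡1+k) = inj₂ (inj₁ (cong U j≡1+k))
    V-tip-antipodes (V i) i<m e = ⊥-elim (<⇒≢ (<-trans (∣m-n∣<m ≤-refl i<m) m<D) e)
    V-tip-antipodes (W i) _ e = inj₂ (inj₂ (cong W (across≡⇒tip e)))

    W-tip-antipodes : ∀ y → Valid y → dist (W a) y ≡ D → y ≡ U (suc k) ⊎ y ≡ U (suc (suc k)) ⊎ y ≡ V a
    W-tip-antipodes (U zero) _ e = ⊥-elim (<⇒≢ (+-monoʳ-< (suc a) (subst (_< k) (sym cycDist-0-1) 2≤k)) e)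
    W-tip-antipodes (U (suc j)) 1+j<n e with arc≡k⇒ (<-trans (n<1+n j) 1+j<n) (+-cancelˡ-≡ (suc a) _ _ e)
    ... | inj₁ j≡k = inj₁ (cong (U ∘ suc) j≡k)
    ... | inj₂ (_ , j≡1+k) = inj₂ (inj₁ (cong (U ∘ suc) j≡1+k))
    W-tip-antipodes (W i) i<m e = ⊥-elim (<⇒≢ (<-trans (∣m-n∣<m ≤-refl i<m) m<D) e)
    W-tip-antipodes (V i) _ e = inj₂ (inj₂ (cong V (across≡⇒tip e)))

    U1+k-neighbours : ∀ y → Valid y → dist (U (suc k)) y ≡ 1 → y ≡ U k ⊎ y ≡ U (suc (suc k))
    U1+k-neighbours (U j) j<n e with ⊓-sel ∣ suc k - j ∣ (n ∸ ∣ suc k - j ∣)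
    ... | inj₁ arc≡t = Data.Sum.map (cong U) (cong U) (∣1+m-n∣≡1⇒ k j (trans (sym arc≡t) e))
    ... | inj₂ arc≡n∸t = ⊥-elim (<⇒≢ 1<n∸t (sym (trans (sym arc≡n∸t) e)))
      where
      t≤1+k : ∣ suc k - j ∣ ≤ suc k
      t≤1+k with ∣m-n∣≡[m∸n]∨[n∸m] (suc k) j
      ... | inj₁ t≡ = ≤-trans (≤-reflexive t≡) (m∸n≤m (suc k) j)
      ... | inj₂ t≡ = ≤-trans (≤-reflexive t≡) (≤-trans (m≤n+o⇒m∸n≤o j (suc k) (≤-trans (<⇒≤ j<n) (≤-reflexive n≡1+k+k))) (n≤1+n k))
      1<n∸t : 1 < n ∸ ∣ suc k - j ∣
      1<n∸t = ≤-trans 2≤k (≤-trans (≤-reflexive (sym n∸1+k≡k)) (∸-monoʳ-≤ n t≤1+k))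
    U1+k-neighbours (V i) _ e = ⊥-elim (0≢1+n (sym (cycDist≡0⇒≡0 1+k<n (m+1+n≡1⇒m≡0 _ i e))))
    U1+k-neighbours (W i) _ e =
      ⊥-elim (0≢1+n (trans (sym (m+1+n≡1⇒m≡0 _ i e)) (trans (cycDist-comm (suc k) 1) arc-k)))

    U2+k-antipode : ∀ y → Valid y → dist (U (suc (suc k))) y ≡ D → y ≡ W a
    U2+k-antipode (U j) _ e = ⊥-elim (<⇒≢ (≤-<-trans (cycDist≤k (suc (suc k)) j) k<D) e)
    U2+k-antipode (V i) i<m e = ⊥-elim (<⇒≢ (+-mono-≤-< d≤m (s≤s i<m)) e)
      where
      d≤m : cycDist (suc (suc k)) 0 ≤ m
      d≤m = ≤-trans (≤-reflexive (cycDist-comm (suc (suc k)) 0)) (≤-trans (arc≤n∸ (suc (suc k))) (m≤n+o⇒m∸n≤o n (suc (suc k)) (≤-reflexive (trans n≡1+k+k (+-suc (suc k) m)))))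
    U2+k-antipode (W i) i<m e = cong W (path-end (cycDist≤k (suc (suc k)) 1) i<m e)

    Uk-antipode : ∀ y → Valid y → dist (U k) y ≡ D → y ≡ V a
    Uk-antipode (U j) _ e = ⊥-elim (<⇒≢ (≤-<-trans (cycDist≤k k j) k<D) e)
    Uk-antipode (V i) i<m e = cong V (path-end (cycDist≤k k 0) i<m e)
    Uk-antipode (W i) i<m e = ⊥-elim (<⇒≢ (+-mono-≤-< (≤-trans (≤-reflexive (cycDist-comm k 1)) (arc≤ m)) (s≤s i<m)) e)

    U1+k-sees-spine : ∀ y → Valid y →
      dist (U (suc k)) y ≡ 0 ⊎ ∃ λ q → q < k + k × dist (U (suc k)) (spine q) ≡ dist (U (suc k)) y
    U1+k-sees-spine y y-valid = realise (dist≤D (U (suc k)) y 1+k<n y-valid)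
      where
      realise : ∀ {d} → d ≤ D → d ≡ 0 ⊎ ∃ λ q → q < k + k × dist (U (suc k)) (spine q) ≡ d
      realise {zero} _ = inj₁ refl
      realise {suc d} d≤D with suc d ≤? k
      ... | yes 1+d≤k = inj₂ (m + (k ∸ d) , m+i<2k (m∸n≤m k d) , (begin
        dist (U (suc k)) (spine (m + (k ∸ d)))  ≡⟨ cong (dist (U (suc k))) (spine-cycle (k ∸ d)) ⟩
        arc ∣ suc k - k ∸ d ∣                  ≡⟨ cong arc (trans (m≤n⇒∣n-m∣≡n∸m (≤-trans (m∸n≤m k d) (n≤1+n k))) (m∸[m∸n]≡n (s≤s (≤-trans (n≤1+n d) 1+d≤k)))) ⟩
        arc (suc d)                            ≡⟨ t≤k⇒arc≡t 1+d≤k ⟩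
        suc d                                  ∎))
        where open ≡-Reasoning
      ... | no 1+d≰k with m≤n⇒∃[o]m+o≡n (≰⇒> 1+d≰k)
      ...   | o , k+1+o≡1+d = inj₂ (a ∸ o , a∸j<2k o , (begin
        dist (U (suc k)) (spine (a ∸ o))       ≡⟨ cong (dist (U (suc k))) (trans (spine-path (s≤s (m∸n≤m a o))) (cong V (m∸[m∸n]≡n o≤a))) ⟩
        cycDist (suc k) 0 + suc o              ≡⟨ cong (_+ suc o) (trans (cycDist-comm (suc k) 0) arc-1+k) ⟩
        k + suc o                              ≡⟨ trans (+-suc k o) k+1+o≡1+d ⟩
        suc d                                  ∎))
        where
        open ≡-Reasoning
        o≤a : o ≤ a
        o≤a = s≤s⁻¹ (+-cancelˡ-≤ k (suc o) m (≤-trans (≤-reflexive (trans (+-suc k o) k+1+o≡1+d)) (≤-trans d≤D (≤-reflexive (+-comm m k)))))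

module CuttlefishGraph (n a p : ℕ) (n≡ : n ≡ suc (suc a) + suc (suc a) + p) (p≤1 : p ≤ 1)
                       (cfm≡ : cfm n ≡ suc a) where

  open CuttlefishGeometry n a p n≡ p≤1 public
  open Graph (CF n) public using (N; Adj)

  index : Vertex → ℕ
  index (U i) = i
  index (V j) = n + j
  index (W j) = n + cfm n + j

  vertex : ℕ → Vertex
  vertex x with x <? n
  ... | yes _ = U x
  ... | no _ with x ∸ n <? cfm n
  ...   | yes _ = V (x ∸ n)
  ...   | no _ = W (x ∸ n ∸ cfm n)

  vertex-U : ∀ {i} → i < n → vertex i ≡ U i
  vertex-U {i} i<n with i <? n
  ... | yes _ = refl
  ... | no i≮n = ⊥-elim (i≮n i<n)

  vertex-V : ∀ {j} → j < cfm n → vertex (n + j) ≡ V j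
  vertex-V {j} j<m with n + j <? n
  ... | yes n+j<n = ⊥-elim (<⇒≱ n+j<n (m≤m+n n j))
  ... | no _ with n + j ∸ n <? cfm n
  ...   | yes _ = cong V (m+n∸m≡n n j)
  ...   | no j≮m = ⊥-elim (j≮m (subst (_< cfm n) (sym (m+n∸m≡n n j)) j<m))

  n+m+j∸n≡m+j : ∀ j → n + cfm n + j ∸ n ≡ cfm n + j
  n+m+j∸n≡m+j j = trans (cong (_∸ n) (+-assoc n (cfm n) j)) (m+n∸m≡n n (cfm n + j))

  vertex-W : ∀ {j} → j < cfm n → vertex (n + cfm n + j) ≡ W j
  vertex-W {j} j<m with n + cfm n + j <? n
  ... | yes lt = ⊥-elim (<⇒≱ lt (≤-trans (m≤m+n n (cfm n)) (m≤m+n (n + cfm n) j)))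
  ... | no _ with n + cfm n + j ∸ n <? cfm n
  ...   | yes lt = ⊥-elim (<⇒≱ lt (≤-trans (m≤m+n (cfm n) j) (≤-reflexive (sym (n+m+j∸n≡m+j j)))))
  ...   | no _ = cong W (trans (cong (_∸ cfm n) (n+m+j∸n≡m+j j)) (m+n∸m≡n (cfm n) j))

  m≡cfm : m ≡ cfm n
  m≡cfm = sym cfm≡

  index<N : ∀ t → Valid t → index t < N
  index<N (U i) i<n = ≤-trans i<n (≤-trans (m≤m+n n (cfm n)) (m≤m+n (n + cfm n) (cfm n)))
  index<N (V j) j<m = ≤-trans (+-monoʳ-< n (subst (j <_) m≡cfm j<m)) (m≤m+n (n + cfm n) (cfm n))
  index<N (W j) j<m = +-monoʳ-< (n + cfm n) (subst (j <_) m≡cfm j<m)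

  vertex-index : ∀ t → Valid t → vertex (index t) ≡ t
  vertex-index (U i) i<n = vertex-U i<n
  vertex-index (V j) j<m = vertex-V (subst (j <_) m≡cfm j<m)
  vertex-index (W j) j<m = vertex-W (subst (j <_) m≡cfm j<m)

  index-vertex : ∀ x → x < N → index (vertex x) ≡ x × Valid (vertex x)
  index-vertex x x<N with x <? n
  ... | yes x<n = refl , x<n
  ... | no x≮n with x ∸ n <? cfm n
  ...   | yes x∸n<m = m+[n∸m]≡n (≮⇒≥ x≮n) , subst (x ∸ n <_) cfm≡ x∸n<m
  ...   | no x∸n≮m = index≡x , subst (x ∸ n ∸ cfm n <_) cfm≡ (+-cancelˡ-< (n + cfm n) _ _ (subst (_< N) (sym index≡x) x<N))
    where
    index≡x : n + cfm n + (x ∸ n ∸ cfm n) ≡ x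
    index≡x = trans (+-assoc n (cfm n) _) (trans (cong (n +_) (m+[n∸m]≡n (≮⇒≥ x∸n≮m))) (m+[n∸m]≡n (≮⇒≥ x≮n)))

  toVertex : Fin N → Vertex
  toVertex x = vertex (toℕ x)

  toVertex-valid : ∀ x → Valid (toVertex x)
  toVertex-valid x = proj₂ (index-vertex (toℕ x) (toℕ<n x))

  index-toVertex : ∀ x → index (toVertex x) ≡ toℕ x
  index-toVertex x = proj₁ (index-vertex (toℕ x) (toℕ<n x))

  toVertex-injective : ∀ {x y} → toVertex x ≡ toVertex y → x ≡ y
  toVertex-injective {x} {y} e = toℕ-injective (trans (sym (index-toVertex x)) (trans (cong index e) (index-toVertex y)))

  fromVertex : ∀ t → Valid t → Fin N
  fromVertex t t-valid = fromℕ< (index<N t t-valid)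

  toℕ-fromVertex : ∀ t t-valid → toℕ (fromVertex t t-valid) ≡ index t
  toℕ-fromVertex t t-valid = toℕ-fromℕ< (index<N t t-valid)

  toVertex-fromVertex : ∀ t t-valid → toVertex (fromVertex t t-valid) ≡ t
  toVertex-fromVertex t t-valid = trans (cong vertex (toℕ-fromVertex t t-valid)) (vertex-index t t-valid)

  toVertex≡⇒≡fromVertex : ∀ {x t} t-valid → toVertex x ≡ t → x ≡ fromVertex t t-valid
  toVertex≡⇒≡fromVertex {t = t} t-valid e = toVertex-injective (trans e (sym (toVertex-fromVertex t t-valid)))

  0<cfm : 0 < cfm n
  0<cfm = subst (0 <_) m≡cfm (s≤s z≤n)

  edge⇒CFEdge : ∀ {s t} → Edge s t → CFEdge n (index s) (index t)
  edge⇒CFEdge (uu (next 1+i<n)) = cyc 1+i<n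
  edge⇒CFEdge (uu wrap) = wrap
  edge⇒CFEdge uv = subst (CFEdge n 0) (sym (+-identityʳ n)) (uv 0<cfm)
  edge⇒CFEdge (vv {j} 1+j<m) = vv (subst (suc j <_) m≡cfm 1+j<m)
  edge⇒CFEdge uw = subst (CFEdge n 1) (sym (+-identityʳ (n + cfm n))) (uw 0<cfm)
  edge⇒CFEdge (ww {j} 1+j<m) = ww (subst (suc j <_) m≡cfm 1+j<m)

  CFEdge⇒edge : ∀ {i j} → CFEdge n i j → Edge (vertex i) (vertex j)
  CFEdge⇒edge (cyc {i} 1+i<n) rewrite vertex-U (<-trans (n<1+n i) 1+i<n) | vertex-U 1+i<n = uu (next 1+i<n)
  CFEdge⇒edge wrap rewrite vertex-U n∸1<n | vertex-U 0<n = uu wrap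
  CFEdge⇒edge (uv 0<m) rewrite vertex-U 0<n | trans (cong vertex (sym (+-identityʳ n))) (vertex-V 0<m) = uv
  CFEdge⇒edge (vv {j} 1+j<m) rewrite vertex-V (<-trans (n<1+n j) 1+j<m) | vertex-V 1+j<m = vv (subst (suc j <_) cfm≡ 1+j<m)
  CFEdge⇒edge (uw 0<m) rewrite vertex-U 1<n | trans (cong vertex (sym (+-identityʳ (n + cfm n)))) (vertex-W 0<m) = uw
  CFEdge⇒edge (ww {j} 1+j<m) rewrite vertex-W (<-trans (n<1+n j) 1+j<m) | vertex-W 1+j<m = ww (subst (suc j <_) cfm≡ 1+j<m)

  Adj⇒Edge : ∀ {x y} → Adj x y → Edge (toVertex x) (toVertex y) ⊎ Edge (toVertex y) (toVertex x)
  Adj⇒Edge = Data.Sum.map CFEdge⇒edge CFEdge⇒edge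

  Edge⇒Adj : ∀ {x y} → Edge (toVertex x) (toVertex y) → Adj x y
  Edge⇒Adj {x} {y} e = inj₁ (subst₂ (CFEdge n) (index-toVertex x) (index-toVertex y) (edge⇒CFEdge e))

  δ : Fin N → Fin N → ℕ
  δ x y = dist (toVertex x) (toVertex y)

  open GraphGame (CF n) public

  δ-lipschitz : ∀ b → Lipschitz (δ b)
  δ-lipschitz b x~y with Adj⇒Edge x~y
  ... | inj₁ e = proj₁ (dist-lipschitz (toVertex b) (toVertex-valid b) e)
  ... | inj₂ e = proj₂ (dist-lipschitz (toVertex b) (toVertex-valid b) e)

  δ-parent : ∀ {b y t} → δ b y ≡ suc t → ∃ λ y' → Adj y' y × δ b y' ≡ t
  δ-parent {b} {y} {t} e with dist-parent (toVertex b) (toVertex y) (toVertex-valid b) (toVertex-valid y) e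
  ... | s , s-valid , s~y , e' = fromVertex s s-valid , adj s~y , subst (λ z → dist (toVertex b) z ≡ t) (sym y'↦s) e'
    where
    y'↦s : toVertex (fromVertex s s-valid) ≡ s
    y'↦s = toVertex-fromVertex s s-valid
    adj : Edge s (toVertex y) ⊎ Edge (toVertex y) s → Adj (fromVertex s s-valid) y
    adj (inj₁ e₁) = Edge⇒Adj (subst (λ z → Edge z (toVertex y)) (sym y'↦s) e₁)
    adj (inj₂ e₂) = Data.Sum.swap (Edge⇒Adj {y} (subst (Edge (toVertex y)) (sym y'↦s) e₂))

  open Metric δ (λ b → dist-self (toVertex b))
    (λ {b} {y} e → toVertex-injective (dist≡0⇒≡ (toVertex b) (toVertex y) (toVertex-valid b) (toVertex-valid y) e))
    δ-lipschitz δ-parent public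

-- The game on CF_n

module CuttlefishGame (n a p : ℕ) (n≡ : n ≡ suc (suc a) + suc (suc a) + p) (p≤1 : p ≤ 1)
                      (cfm≡ : cfm n ≡ suc a) where

  open CuttlefishGraph n a p n≡ p≤1 cfm≡ public

  K₀ : ℕ
  K₀ = k + k

  Forces : ℕ → Subset N → Fin N → Set
  Forces = ExplorerForces (CF n)

  δ-via : ∀ {u y t s d} → toVertex u ≡ t → toVertex y ≡ s → dist t s ≡ d → δ u y ≡ d
  δ-via refl refl e = e

  δ-from : ∀ {u y t d} → toVertex u ≡ t → δ u y ≡ d → dist t (toVertex y) ≡ d
  δ-from refl e = e

  witness : ∀ {u t d} → toVertex u ≡ t → (∃ λ s → Valid s × dist t s ≡ d) → ∃ λ w → δ u w ≡ d
  witness u↦t (s , s-valid , e) = fromVertex s s-valid , δ-via u↦t (toVertex-fromVertex s s-valid) e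

  ∉-via : ∀ {S y t} t-valid → toVertex y ≡ t → fromVertex t t-valid ∉ S → y ∉ S
  ∉-via t-valid y↦t t∉S rewrite toVertex≡⇒≡fromVertex t-valid y↦t = t∉S

  ValidBelowK₀ : (ℕ → Vertex) → Set
  ValidBelowK₀ g = ∀ {q} → q < K₀ → Valid (g q)

  -- the values beyond K₀ are junk
  embed : (g : ℕ → Vertex) → ValidBelowK₀ g → ℕ → Fin N
  embed g valid q with q <? K₀
  ... | yes q<K₀ = fromVertex (g q) (valid q<K₀)
  ... | no _ = fromVertex (U 0) 0<n

  toVertex-embed : ∀ g (valid : ValidBelowK₀ g) {q} → q < K₀ → toVertex (embed g valid q) ≡ g q
  toVertex-embed g valid {q} q<K₀ with q <? K₀
  ... | yes q<K₀′ = toVertex-fromVertex (g q) (valid q<K₀′)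
  ... | no q≮K₀ = ⊥-elim (q≮K₀ q<K₀)

  mirror-spine : ℕ → Vertex
  mirror-spine = mirror ∘ spine

  Spine Mirror : Subset N
  Spine = image (embed spine spine-valid) K₀
  Mirror = image (embed mirror-spine (mirror-valid ∘ spine-valid)) K₀

  δ-embed : ∀ g (valid : ValidBelowK₀ g) {q} y → q < K₀ → δ (embed g valid q) y ≡ dist (g q) (toVertex y)
  δ-embed g valid y q<K₀ = cong (λ t → dist t (toVertex y)) (toVertex-embed g valid q<K₀)

  embedded-geodesic-closed : ∀ g (valid : ValidBelowK₀ g) →
    (∀ {q q'} → q < K₀ → q' < K₀ → dist (g q) (g q') ≡ ∣ q - q' ∣) →
    (∀ {q} → q < K₀ → ∀ y → Valid y → dist (g q) y ≤ q ⊎ q + dist (g q) y ≤ D) →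
    Closed (image (embed g valid) K₀)
  embedded-geodesic-closed g valid isometric short = geodesic-closed (embed g valid) K₀
    (λ q<K₀ q'<K₀ → trans (δ-embed g valid _ q<K₀) (trans (cong (dist (g _)) (toVertex-embed g valid q'<K₀)) (isometric q<K₀ q'<K₀)))
    (λ {q} q<K₀ y → subst (λ d → d ≤ q ⊎ q + d < K₀) (sym (δ-embed g valid y q<K₀))
       (Data.Sum.map id s≤s (short q<K₀ (toVertex y) (toVertex-valid y))))

  Spine-closed : Closed Spine
  Spine-closed = embedded-geodesic-closed spine spine-valid
    (λ q<K₀ q'<K₀ → spine-isometric (on-spine q<K₀) (on-spine q'<K₀))
    (λ q<K₀ → spine-short (on-spine q<K₀))

  Mirror-closed : Closed Mirror
  Mirror-closed = embedded-geodesic-closed mirror-spine (mirror-valid ∘ spine-valid)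
    (λ q<K₀ q'<K₀ → trans (mirror-isometric _ _ (spine-valid q<K₀) (spine-valid q'<K₀)) (spine-isometric (on-spine q<K₀) (on-spine q'<K₀)))
    (λ {q} q<K₀ y y-valid → subst (λ d → d ≤ q ⊎ q + d ≤ D) (mirror-dist q<K₀ y y-valid)
       (spine-short (on-spine q<K₀) (mirror y) (mirror-valid y-valid)))
    where
    mirror-dist : ∀ {q} → q < K₀ → ∀ y → Valid y → dist (spine q) (mirror y) ≡ dist (mirror-spine q) y
    mirror-dist {q} q<K₀ y y-valid = begin
      dist (spine q) (mirror y)                   ≡⟨ sym (mirror-isometric (spine q) (mirror y) (spine-valid q<K₀) (mirror-valid y-valid)) ⟩
      dist (mirror-spine q) (mirror (mirror y))   ≡⟨ cong (dist (mirror-spine q)) (mirror-involutive y-valid) ⟩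
      dist (mirror-spine q) y                     ∎
      where open ≡-Reasoning

  Tip : Fin N → Set
  Tip b = IsTip (toVertex b)

  tip-rich : ∀ {b} → Tip b → ∀ {d} → d < K₀ → ∃ λ w → δ b w ≡ d
  tip-rich (inj₁ b↦Va) d<K₀ = witness b↦Va (spine _ , spine-valid d<K₀ , spine-isometric (on-path z≤n) (on-spine d<K₀))
  tip-rich (inj₂ b↦Wa) d<K₀ = witness b↦Wa (mirror-spine _ , mirror-valid (spine-valid d<K₀) ,
    trans (mirror-isometric (V a) (spine _) ≤-refl (spine-valid d<K₀)) (spine-isometric (on-path z≤n) (on-spine d<K₀)))

  via-tips : ∀ {K S} → (∀ {b} → Tip b → Forces K S b) → FreshForces K S → ∀ {u} → Forces K S u
  via-tips {K} {S} at-tip fresh {u} with eccentric-move (toVertex u) (toVertex-valid u)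
  ... | e , far , lands = explore e (witness refl far) λ w δ≡e →
    landing fresh λ _ → from-landing w (lands (toVertex w) (toVertex-valid w) δ≡e)
    where
    from-landing : ∀ w → TipOrFacing (toVertex w) → Forces K S w
    from-landing w (inj₁ tip) = at-tip tip
    from-landing w (inj₂ (antipode , only-tips)) = explore D (witness refl antipode) λ y δ≡D →
      landing fresh λ _ → at-tip (only-tips (toVertex y) (toVertex-valid y) δ≡D)

  explorer-forces-K₀ : ∀ v → Forces K₀ ⁅ v ⁆ v
  explorer-forces-K₀ v = forces-by-progress K₀ (λ _ → ⊤) (λ _ → tt)
    (λ {S} _ ∣S∣<K₀ fresh → via-tips (λ tip → rich-progress (tip-rich tip) ∣S∣<K₀ (λ {z} z∈S → z , z∈S , refl) fresh) fresh) tt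

  ∈-embed : ∀ g (valid : ValidBelowK₀ g) {q v} → q < K₀ → g q ≡ toVertex v → v ∈ image (embed g valid) K₀
  ∈-embed g valid {q} q<K₀ gq≡v = subst (_∈ image (embed g valid) K₀)
    (toVertex-injective (trans (toVertex-embed g valid q<K₀) gq≡v)) (∈image⁺ (embed g valid) q<K₀)

  director-caps-K₀ : ∀ v → (p ≡ 1 → toVertex v ≢ U (suc k)) → ¬ Forces (suc K₀) ⁅ v ⁆ v
  director-caps-K₀ v not-special with spine-or-mirror (toVertex v) (toVertex-valid v) not-special
  ... | inj₁ (q , q<K₀ , e) = director-caps Spine-closed (∣image∣≤ _ K₀) (∈-embed spine spine-valid q<K₀ e)
  ... | inj₂ (q , q<K₀ , e) = director-caps Mirror-closed (∣image∣≤ _ K₀) (∈-embed mirror-spine (mirror-valid ∘ spine-valid) q<K₀ e)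

  fd-K₀ : ∀ v → (p ≡ 1 → toVertex v ≢ U (suc k)) → FdValue (CF n) v K₀
  fd-K₀ v not-special = explorer-forces-K₀ v , director-caps-K₀ v not-special

  module OddStart (p≡1 : p ≡ 1) where
    open Odd p≡1

    u⋆ Uk U2+k Va Wa : Fin N
    u⋆ = fromVertex (U (suc k)) 1+k<n
    Uk = fromVertex (U k) k<n
    U2+k = fromVertex (U (suc (suc k))) 2+k<n
    Va = fromVertex (V a) ≤-refl
    Wa = fromVertex (W a) ≤-refl

    u⋆↦ : toVertex u⋆ ≡ U (suc k)
    u⋆↦ = toVertex-fromVertex _ 1+k<n
    Uk↦ : toVertex Uk ≡ U k
    Uk↦ = toVertex-fromVertex _ k<n
    U2+k↦ : toVertex U2+k ≡ U (suc (suc k))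
    U2+k↦ = toVertex-fromVertex _ 2+k<n
    Va↦ : toVertex Va ≡ V a
    Va↦ = toVertex-fromVertex _ ≤-refl
    Wa↦ : toVertex Wa ≡ W a
    Wa↦ = toVertex-fromVertex _ ≤-refl

    ≢u⋆ : ∀ {x t} → toVertex x ≡ t → t ≢ U (suc k) → x ≢ u⋆
    ≢u⋆ x↦t t≢ refl = t≢ (trans (sym x↦t) u⋆↦)

    -- A visited x ≠ u⋆ as far from b as u⋆ lets the count of distinct
    -- distances from b ignore u⋆.
    twin-progress : ∀ {S b x d} → Tip b → u⋆ ∈ S → ∣ S ∣ < suc K₀ → x ∈ S → x ≢ u⋆ →
      δ b x ≡ d → δ b u⋆ ≡ d → FreshForces (suc K₀) S → Forces (suc K₀) S b
    twin-progress {S} {b} {x} tip u⋆∈S ∣S∣≤K₀ x∈S x≢u⋆ δx≡d δu⋆≡d fresh =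
      rich-progress (tip-rich tip) (<-≤-trans (x∈p⇒∣p-x∣<∣p∣ u⋆∈S) (s≤s⁻¹ ∣S∣≤K₀)) represented fresh
      where
      represented : ∀ {z} → z ∈ S → ∃ λ z' → z' ∈ S ∖ u⋆ × δ b z' ≡ δ b z
      represented {z} z∈S with z ≟ᶠ u⋆
      ... | yes refl = x , x∈p∧x≢y⇒x∈p-y x∈S x≢u⋆ , trans δx≡d (sym δu⋆≡d)
      ... | no z≢u⋆ = z , x∈p∧x≢y⇒x∈p-y z∈S z≢u⋆ , refl

    at-V-tip : ∀ {S b} → toVertex b ≡ V a → u⋆ ∈ S → ∣ S ∣ < suc K₀ → FreshForces (suc K₀) S →
      Forces (suc K₀) S b
    at-V-tip {S} {b} b↦ u⋆∈S ∣S∣≤K₀ fresh with Uk ∈? S | Wa ∈? S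
    ... | yes Uk∈S | _ = twin-progress (inj₁ b↦) u⋆∈S ∣S∣≤K₀ Uk∈S (≢u⋆ Uk↦ λ ())
      (δ-via b↦ Uk↦ V-tip-to-Uk) (δ-via b↦ u⋆↦ V-tip-to-U1+k) fresh
    ... | no _ | yes Wa∈S = twin-progress (inj₁ b↦) u⋆∈S ∣S∣≤K₀ Wa∈S (≢u⋆ Wa↦ λ ())
      (δ-via b↦ Wa↦ (tip-to-tip a)) (δ-via b↦ u⋆↦ V-tip-to-U1+k) fresh
    ... | no Uk∉S | no Wa∉S = explore D (u⋆ , δ-via b↦ u⋆↦ V-tip-to-U1+k) λ y δ≡D →
      from-antipode y (V-tip-antipodes (toVertex y) (toVertex-valid y) (δ-from b↦ δ≡D))
      where
      from-U2+k : ∀ {z} → toVertex z ≡ U (suc (suc k)) → Forces (suc K₀) S z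
      from-U2+k z↦ = explore D (Wa , δ-via z↦ Wa↦ U2+k-to-W-tip) λ w δ≡D →
        fresh w (∉-via ≤-refl (U2+k-antipode (toVertex w) (toVertex-valid w) (δ-from z↦ δ≡D)) Wa∉S)
      from-u⋆ : ∀ {y} → toVertex y ≡ U (suc k) → Forces (suc K₀) S y
      from-u⋆ y↦ = explore 1 (Uk , δ-via y↦ Uk↦ U1+k-to-Uk) λ z δ≡1 →
        from-neighbour z (U1+k-neighbours (toVertex z) (toVertex-valid z) (δ-from y↦ δ≡1))
        where
        from-neighbour : ∀ z → toVertex z ≡ U k ⊎ toVertex z ≡ U (suc (suc k)) → Forces (suc K₀) (S ∪ ⁅ z ⁆) z
        from-neighbour z (inj₁ z↦Uk) = fresh z (∉-via k<n z↦Uk Uk∉S)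
        from-neighbour z (inj₂ z↦U2+k) = landing fresh λ _ → from-U2+k z↦U2+k
      from-antipode : ∀ y → toVertex y ≡ U k ⊎ toVertex y ≡ U (suc k) ⊎ toVertex y ≡ W a →
        Forces (suc K₀) (S ∪ ⁅ y ⁆) y
      from-antipode y (inj₁ y↦Uk) = fresh y (∉-via k<n y↦Uk Uk∉S)
      from-antipode y (inj₂ (inj₁ y↦u⋆)) = landing fresh λ _ → from-u⋆ y↦u⋆
      from-antipode y (inj₂ (inj₂ y↦Wa)) = fresh y (∉-via ≤-refl y↦Wa Wa∉S)

    at-W-tip : ∀ {S b} → toVertex b ≡ W a → u⋆ ∈ S → ∣ S ∣ < suc K₀ → FreshForces (suc K₀) S →
      Forces (suc K₀) S b
    at-W-tip {S} {b} b↦ u⋆∈S ∣S∣≤K₀ fresh with U2+k ∈? S | Va ∈? S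
    ... | yes U2+k∈S | _ = twin-progress (inj₂ b↦) u⋆∈S ∣S∣≤K₀ U2+k∈S (≢u⋆ U2+k↦ λ ())
      (δ-via b↦ U2+k↦ W-tip-to-U2+k) (δ-via b↦ u⋆↦ W-tip-to-U1+k) fresh
    ... | no _ | yes Va∈S = twin-progress (inj₂ b↦) u⋆∈S ∣S∣≤K₀ Va∈S (≢u⋆ Va↦ λ ())
      (δ-via b↦ Va↦ (tip-to-tip a)) (δ-via b↦ u⋆↦ W-tip-to-U1+k) fresh
    ... | no U2+k∉S | no Va∉S = explore D (u⋆ , δ-via b↦ u⋆↦ W-tip-to-U1+k) λ y δ≡D →
      from-antipode y (W-tip-antipodes (toVertex y) (toVertex-valid y) (δ-from b↦ δ≡D))
      where
      from-Uk : ∀ {z} → toVertex z ≡ U k → Forces (suc K₀) S z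
      from-Uk z↦ = explore D (Va , δ-via z↦ Va↦ Uk-to-V-tip) λ w δ≡D →
        fresh w (∉-via ≤-refl (Uk-antipode (toVertex w) (toVertex-valid w) (δ-from z↦ δ≡D)) Va∉S)
      from-u⋆ : ∀ {y} → toVertex y ≡ U (suc k) → Forces (suc K₀) S y
      from-u⋆ y↦ = explore 1 (Uk , δ-via y↦ Uk↦ U1+k-to-Uk) λ z δ≡1 →
        from-neighbour z (U1+k-neighbours (toVertex z) (toVertex-valid z) (δ-from y↦ δ≡1))
        where
        from-neighbour : ∀ z → toVertex z ≡ U k ⊎ toVertex z ≡ U (suc (suc k)) → Forces (suc K₀) (S ∪ ⁅ z ⁆) z
        from-neighbour z (inj₁ z↦Uk) = landing fresh λ _ → from-Uk z↦Uk
        from-neighbour z (inj₂ z↦U2+k) = fresh z (∉-via 2+k<n z↦U2+k U2+k∉S)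
      from-antipode : ∀ y → toVertex y ≡ U (suc k) ⊎ toVertex y ≡ U (suc (suc k)) ⊎ toVertex y ≡ V a →
        Forces (suc K₀) (S ∪ ⁅ y ⁆) y
      from-antipode y (inj₁ y↦u⋆) = landing fresh λ _ → from-u⋆ y↦u⋆
      from-antipode y (inj₂ (inj₁ y↦U2+k)) = fresh y (∉-via 2+k<n y↦U2+k U2+k∉S)
      from-antipode y (inj₂ (inj₂ y↦Va)) = fresh y (∉-via ≤-refl y↦Va Va∉S)

    explorer-forces-odd : Forces (suc K₀) ⁅ u⋆ ⁆ u⋆
    explorer-forces-odd = forces-by-progress (suc K₀) (u⋆ ∈_) (p⊆p∪q _)
      (λ u⋆∈S ∣S∣≤K₀ fresh → via-tips (at-tip u⋆∈S ∣S∣≤K₀ fresh) fresh) (x∈⁅x⁆ u⋆)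
      where
      at-tip : ∀ {S b} → u⋆ ∈ S → ∣ S ∣ < suc K₀ → FreshForces (suc K₀) S → Tip b → Forces (suc K₀) S b
      at-tip u⋆∈S ∣S∣≤K₀ fresh (inj₁ b↦Va) = at-V-tip b↦Va u⋆∈S ∣S∣≤K₀ fresh
      at-tip u⋆∈S ∣S∣≤K₀ fresh (inj₂ b↦Wa) = at-W-tip b↦Wa u⋆∈S ∣S∣≤K₀ fresh

    Spine⋆ : Subset N
    Spine⋆ = Spine ∪ ⁅ u⋆ ⁆

    Spine⋆-closed : Closed Spine⋆
    Spine⋆-closed = closed-∪-⁅⁆ Spine-closed from-u⋆
      where
      from-u⋆ : ∀ y → ∃ λ z → z ∈ Spine⋆ × δ u⋆ z ≡ δ u⋆ y
      from-u⋆ y with U1+k-sees-spine (toVertex y) (toVertex-valid y)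
      ... | inj₁ d≡0 = u⋆ , x∈p∪q⁺ (inj₂ (x∈⁅x⁆ u⋆)) , trans (dist-self (toVertex u⋆)) (sym (δ-via u⋆↦ refl d≡0))
      ... | inj₂ (q , q<K₀ , e) = embed spine spine-valid q , p⊆p∪q ⁅ u⋆ ⁆ (∈image⁺ _ q<K₀) ,
        trans (δ-via u⋆↦ (toVertex-embed spine spine-valid q<K₀) e) (sym (δ-via u⋆↦ refl refl))

    ∣Spine⋆∣≤1+K₀ : ∣ Spine⋆ ∣ ≤ suc K₀
    ∣Spine⋆∣≤1+K₀ = begin
      ∣ Spine ∪ ⁅ u⋆ ⁆ ∣        ≤⟨ ∣p∪q∣≤∣p∣+∣q∣ Spine ⁅ u⋆ ⁆ ⟩
      ∣ Spine ∣ + ∣ ⁅ u⋆ ⁆ ∣    ≤⟨ +-mono-≤ (∣image∣≤ _ K₀) (≤-reflexive (∣⁅x⁆∣≡1 u⋆)) ⟩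
      K₀ + 1                    ≡⟨ +-comm K₀ 1 ⟩
      suc K₀                    ∎
      where open ≤-Reasoning

    fd-odd : FdValue (CF n) u⋆ (suc K₀)
    fd-odd = explorer-forces-odd , director-caps Spine⋆-closed ∣Spine⋆∣≤1+K₀ (x∈p∪q⁺ (inj₂ (x∈⁅x⁆ u⋆)))

n≡⌊n/2⌋+⌊n/2⌋+n%2 : ∀ n → n ≡ n / 2 + n / 2 + n % 2
n≡⌊n/2⌋+⌊n/2⌋+n%2 n = begin
  n                        ≡⟨ m≡m%n+[m/n]*n n 2 ⟩
  n % 2 + n / 2 * 2        ≡⟨ +-comm (n % 2) _ ⟩
  n / 2 * 2 + n % 2        ≡⟨ cong (_+ n % 2) (trans (*-comm (n / 2) 2) (cong (n / 2 +_) (+-identityʳ _))) ⟩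
  n / 2 + n / 2 + n % 2    ∎
  where open ≡-Reasoning

⌊n/2⌋≡2+ : ∀ {n} → 5 ≤ n → ∃ λ a → n / 2 ≡ suc (suc a)
⌊n/2⌋≡2+ {n} 5≤n with m≤n⇒∃[o]m+o≡n (/-monoˡ-≤ 2 (≤-trans (n≤1+n 4) 5≤n))
... | a , 2+a≡n/2 = a , sym 2+a≡n/2

module _ (n a : ℕ) (n/2≡ : n / 2 ≡ suc (suc a)) where

  open CuttlefishGame n a (n % 2)
    (subst (λ h → n ≡ h + h + n % 2) n/2≡ (n≡⌊n/2⌋+⌊n/2⌋+n%2 n)) (s≤s⁻¹ (m%n<n n 2)) (cong (_∸ 1) n/2≡)

  K₀≡ : K₀ ≡ 2 * (n / 2)
  K₀≡ = trans (cong (k +_) (sym (+-identityʳ k))) (cong (2 *_) (sym n/2≡))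

  fd-off-u⋆ : ∀ v → (n % 2 ≡ 1 → toℕ v ≢ suc (n / 2)) → FdValue (CF n) v (2 * (n / 2))
  fd-off-u⋆ v toℕv≢ = subst (FdValue (CF n) v) K₀≡ (fd-K₀ v λ odd v↦u⋆ →
    toℕv≢ odd (trans (sym (index-toVertex v)) (trans (cong index v↦u⋆) (cong suc (sym n/2≡)))))

  fd-u⋆ : n % 2 ≡ 1 → ∀ v → toℕ v ≡ suc (n / 2) → FdValue (CF n) v (2 * (n / 2) + 1)
  fd-u⋆ odd v toℕv≡ = subst₂ (FdValue (CF n)) (sym v≡u⋆) (trans (+-comm 1 K₀) (cong (_+ 1) K₀≡)) fd-odd
    where
    open OddStart odd
    v≡u⋆ : v ≡ u⋆
    v≡u⋆ = toℕ-injective (trans toℕv≡ (trans (cong suc n/2≡) (sym (toℕ-fromVertex (U (suc k)) (Odd.1+k<n odd)))))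

theorem5p2 : (n : ℕ) → 5 ≤ n →
    (n % 2 ≡ 0 → (v : Fin (Graph.N (CF n))) → FdValue (CF n) v (2 * (n / 2)))
    × (n % 2 ≡ 1 →
        ((v : Fin (Graph.N (CF n))) → toℕ v ≢ suc (n / 2) → FdValue (CF n) v (2 * (n / 2)))
        × ((v : Fin (Graph.N (CF n))) → toℕ v ≡ suc (n / 2) → FdValue (CF n) v (2 * (n / 2) + 1)))
theorem5p2 n 5≤n with ⌊n/2⌋≡2+ 5≤n
... | a , n/2≡ =
  (λ even v → fd-off-u⋆ n a n/2≡ v λ odd → ⊥-elim (0≢1+n (trans (sym even) odd))) ,
  (λ odd → (λ v toℕv≢ → fd-off-u⋆ n a n/2≡ v λ _ → toℕv≢) , fd-u⋆ n a n/2≡ odd)
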